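{- Let $(I,J)$ be an instance of \textsc{Variable-Sized Bin Covering} with unit supply and consider the solution of NFD for it. Let $i^*$ be the smallest index such that $u(i^*)>0$ and $u(i^*+1)=0$. Let $i_1,\dots,i_k\in\{1,\dots,i^*\}$ be the indices with $u(i_j)\ge 2d_{i_j}$ for $j=1,\dots,k$, and let $j_1,\dots,j_k$ be the items on these bins. Set $I'=I\setminus\{i_1,\dots,i_k\}$ and $J'=J\setminus\{j_1,\dots,j_k\}$. Then $\mathrm{OPT}(I,J)/\mathrm{NFD}(I,J)\le \mathrm{OPT}(I',J')/\mathrm{NFD}(I',J')$.
   Context: Unit supply \textsc{Variable-Sized Bin Covering}: $m$ individual bins with demands $d_1\ge\dots\ge d_m>0$ and profit equal to demand, items with sizes $s_1\ge\dots\ge s_n>0$; a bin is covered if the items assigned to it have total size at least its demand, and the goal is to maximize the total demand of covered bins; $\mathrm{OPT}$ is the optimum. Algorithm NFD: with $i=1,j=1$, while $j\le n$ and $i\le m$: if $\sum_{l=j}^n s_l<d_i$ leave bin $i$ empty and set $i:=i+1$; otherwise assign items $j,\dots,j'$ to bin $i$, where $j'$ is the smallest index with $\sum_{l=j}^{j'}s_l\ge d_i$, then $i:=i+1$, $j:=j'+1$. $\mathrm{NFD}(I,J)$ is its profit and $u(i)$ the total size NFD assigns to bin $i$. In a sub-instance the bins and items keep their relative order. Ratios $\mathrm{OPT}/\mathrm{NFD}$ are taken to be $1$ if both values are $0$.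
   Formalization: The bin demands and the item sizes take values in the rationals. -}

module Defs where

open import Data.Bool using (Bool; true; false; if_then_else_; _∧_)
open import Data.Nat as ℕ using (ℕ; zero; suc; _∸_)
open import Data.Fin as Fin using (Fin)
open import Data.List using (List; []; _∷_; [_]; _++_; map; foldr; zipWith; length; allFin; concatMap; lookup)
open import Data.Maybe using (Maybe; just; nothing)
open import Data.Product using (_×_; _,_; proj₁; proj₂)
open import Relation.Nullary using (¬_; does; yes; no)
open import Relation.Binary.PropositionalEquality using (_≡_)
open import Data.Rational using (ℚ; 0ℚ; 1ℚ; _+_; _-_; _*_; _≤_; _<_; _⊔_; _÷_; ≢-nonZero)
open import Data.Rational.Properties using (_≤?_; _<?_; _≟_)

sumℚ : List ℚ → ℚ
sumℚ = foldr _+_ 0ℚ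

at : List ℚ → ℕ → ℚ
at []       _       = 0ℚ
at (x ∷ xs) zero    = x
at (x ∷ xs) (suc i) = at xs i

-- Instances: a list of bin demands (d_1,...,d_m) and a list of item
-- sizes (s_1,...,s_n).  Sub-instances are sublists (order kept).

takeCover : ℚ → List ℚ → List ℚ × List ℚ
takeCover d []       = [] , []
takeCover d (s ∷ ss) =
  if does (d ≤? s) then ([ s ] , ss)
  else (let r = takeCover (d - s) ss in (s ∷ proj₁ r , proj₂ r))

-- nfd ds ss = (list of the item blocks NFD puts into each bin, in bin
-- order (one block per bin, [] for a bin left empty), unassigned items)
nfd : List ℚ → List ℚ → List (List ℚ) × List ℚ
nfd []       ss       = [] , ss
nfd (d ∷ ds) []       = map (λ _ → []) (d ∷ ds) , []
nfd (d ∷ ds) (s ∷ ss) =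
  if does (sumℚ (s ∷ ss) <? d)
  then (let r = nfd ds (s ∷ ss) in ([] ∷ proj₁ r , proj₂ r))
  else (let c = takeCover d (s ∷ ss)
            r = nfd ds (proj₂ c)
        in (proj₁ c ∷ proj₁ r , proj₂ r))

gain : ℚ → ℚ → ℚ
gain d load = if does (d ≤? load) then d else 0ℚ

NFD : List ℚ → List ℚ → ℚ
NFD ds ss = sumℚ (zipWith (λ d b → gain d (sumℚ b)) ds (proj₁ (nfd ds ss)))

-- u(i), 1-based; u(i) = 0 for i > m
u : List ℚ → List ℚ → ℕ → ℚ
u ds ss i = at (map sumℚ (proj₁ (nfd ds ss))) (i ∸ 1)

IsIStar : List ℚ → List ℚ → ℕ → Set
IsIStar ds ss i* =
  (1 ℕ.≤ i*) × (i* ℕ.≤ length ds) ×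
  (0ℚ < u ds ss i*) × (u ds ss (suc i*) ≡ 0ℚ) ×
  (∀ i → 1 ℕ.≤ i → i ℕ.< i* → ¬ ((0ℚ < u ds ss i) × (u ds ss (suc i) ≡ 0ℚ)))

-- go i ds blocks: bins (numbered from i) and their NFD blocks;
-- returns (kept bins , items of kept bins)
reduceGo : ℕ → ℕ → List ℚ → List (List ℚ) → List ℚ × List ℚ
reduceGo i* i (d ∷ ds) (b ∷ bs) =
  let r = reduceGo i* (suc i) ds bs in
  if does (i ℕ.≤? i*) ∧ does ((2ℚ * d) ≤? sumℚ b)
  then r
  else (d ∷ proj₁ r , b ++ proj₂ r)
  where 2ℚ = 1ℚ + 1ℚ
reduceGo i* i _ _ = [] , []

reducedBins : List ℚ → List ℚ → ℕ → List ℚ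
reducedBins ds ss i* = proj₁ (reduceGo i* 1 ds (proj₁ (nfd ds ss)))

-- J' = J \ {j_1,...,j_k}  (items of kept bins, then items NFD left unassigned;
-- this is J minus the removed items, in the original order)
reducedItems : List ℚ → List ℚ → ℕ → List ℚ
reducedItems ds ss i* =
  proj₂ (reduceGo i* 1 ds (proj₁ (nfd ds ss))) ++ proj₂ (nfd ds ss)

-- OPT: maximum profit over all assignments of items to bins (each item
-- goes to at most one bin: nothing = unassigned).

allAssign : (m : ℕ) → List ℚ → List (List (ℚ × Maybe (Fin m)))
allAssign m []       = [] ∷ []
allAssign m (s ∷ ss) =
  concatMap (λ a → map (λ t → (s , t) ∷ a) (nothing ∷ map just (allFin m)))
            (allAssign m ss)

load : ∀ {m} → Fin m → List (ℚ × Maybe (Fin m)) → ℚ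
load k []                  = 0ℚ
load k ((s , nothing) ∷ a) = load k a
load k ((s , just k') ∷ a) = if does (k Fin.≟ k') then s + load k a else load k a

profit : (ds : List ℚ) → List (ℚ × Maybe (Fin (length ds))) → ℚ
profit ds a = sumℚ (map (λ k → gain (lookup ds k) (load k a)) (allFin (length ds)))

OPT : List ℚ → List ℚ → ℚ
OPT ds ss = foldr _⊔_ 0ℚ (map (profit ds) (allAssign (length ds) ss))

-- ratio a/b, with the convention 0/0 = 1 (b = 0 only occurs with a = 0)
ratio : ℚ → ℚ → ℚ
ratio a b with b ≟ 0ℚ
... | yes _  = 1ℚ
... | no b≢0 = _÷_ a b {{≢-nonZero b≢0}}

module Submission where

-- Let D be the total demand of the removed bins and (I', J') the reduced
-- instance.  The theorem follows from three facts by the algebra of ratios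
-- (ratio-remove):
--   (1) NFD(I,J) = NFD(I',J') + D: a removed bin is covered, and NFD on the
--       reduced instance fills the kept bins with the very same blocks;
--   (2) NFD ≤ OPT on every instance, and OPT = 0 whenever NFD = 0;
--   (3) OPT(I,J) ≤ OPT(I',J') + D.
-- For (3) we walk through the bins in order (OPT-reduce-from).  Since the
-- items are sorted, a removed bin of demand d holds a single item s ≥ 2d, and
-- deleting the bin together with s costs OPT at most d (OPT-remove-bin): an
-- exchange argument turns any assignment into one of the remaining items
-- that leaves the bin empty.  It needs that every earlier kept bin is either
-- covered by its NFD block or cannot be covered at all, which is where the
-- minimality of i* enters (no empty block follows a nonempty one before i*).

open import Defs
open import Data.Bool using (Bool; true; false; if_then_else_; _∧_; _∨_)
open import Data.Bool.Properties using (if-float; ∧-conicalˡ; ∧-conicalʳ; ∨-identityʳ)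
open import Data.Empty using (⊥; ⊥-elim)
open import Data.Fin as Fin using (Fin; toℕ; fromℕ<)
import Data.Fin.Properties as FinP
open import Data.List using (List; []; _∷_; [_]; _++_; map; foldr; length; concat; zipWith; allFin; lookup; tabulate; null)
import Data.List.Properties as ListP
open import Data.List.Membership.Propositional using (_∈_; find; lose)
open import Data.List.Membership.Propositional.Properties using (∈-concatMap⁺; ∈-concatMap⁻; ∈-map⁺; ∈-map⁻; ∈-allFin; ∈-∃++)
open import Data.List.Relation.Unary.All as All using (All; []; _∷_)
open import Data.List.Relation.Unary.All.Properties using (++⁻ˡ; ++⁻ʳ; ++⁺; concat⁻; ¬Any⇒All¬)
open import Data.List.Relation.Unary.AllPairs as AllPairs using (AllPairs; []; _∷_)
open import Data.List.Relation.Unary.Any using (here; there; any?)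
open import Data.List.Relation.Unary.Linked using (Linked)
open import Data.List.Relation.Unary.Linked.Properties using (Linked⇒AllPairs)
open import Data.Maybe as Maybe using (Maybe; just; nothing; _>>=_)
open import Data.Nat as ℕ using (ℕ; zero; suc)
import Data.Nat.Properties as ℕP
open import Data.Product using (_×_; _,_; proj₁; proj₂; ∃; ∃-syntax)
open import Data.Rational using (ℚ; 0ℚ; 1ℚ; _+_; _-_; _*_; _÷_; 1/_; -_; _≤_; _<_; _≥_; _⊔_; positive; nonNegative; ≢-nonZero)
import Data.Rational.Properties as ℚP
open import Data.Rational.Solver using (module +-*-Solver)
open import Data.Sum using (_⊎_; inj₁; inj₂)
open import Data.Unit using (⊤; tt)
open import Function using (_∘_)
open import Relation.Binary.Definitions using (tri<; tri≈; tri>)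
open import Relation.Binary.PropositionalEquality hiding ([_])
open import Relation.Nullary using (¬_; Dec; does; yes; no)
open import Relation.Nullary.Decidable using (dec-true; dec-false; toSum)

open +-*-Solver using (solve; _:+_; _:-_; _:*_; _:=_; con)

≤-+-nonnegʳ : ∀ x {y} → 0ℚ ≤ y → x ≤ x + y
≤-+-nonnegʳ x {y} y≥0 = subst (_≤ x + y) (ℚP.+-identityʳ x) (ℚP.+-monoʳ-≤ x y≥0)

≤-+-nonnegˡ : ∀ x {y} → 0ℚ ≤ y → x ≤ y + x
≤-+-nonnegˡ x {y} y≥0 = subst (x ≤_) (ℚP.+-comm x y) (≤-+-nonnegʳ x y≥0)

<⇒≱ : ∀ {x y} → x < y → ¬ y ≤ x
<⇒≱ x<y y≤x = ℚP.<-irrefl refl (ℚP.<-≤-trans x<y y≤x)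

≤⇒≯ : ∀ {x y} → x ≤ y → ¬ y < x
≤⇒≯ x≤y y<x = <⇒≱ y<x x≤y

NonNeg : List ℚ → Set
NonNeg = All (0ℚ ≤_)

Positive : List ℚ → Set
Positive = All (0ℚ <_)

if-yes : ∀ {P : Set} {A : Set} (x : Dec P) {a b : A} → P → (if does x then a else b) ≡ a
if-yes x p rewrite dec-true x p = refl

if-no : ∀ {P : Set} {A : Set} (x : Dec P) {a b : A} → ¬ P → (if does x then a else b) ≡ b
if-no x ¬p rewrite dec-false x ¬p = refl

if-true : ∀ {A : Set} {b} {x y : A} → b ≡ true → (if b then x else y) ≡ x
if-true refl = refl

if-false : ∀ {A : Set} {b} {x y : A} → b ≡ false → (if b then x else y) ≡ y
if-false refl = refl

does-true : ∀ {P : Set} (x : Dec P) → does x ≡ true → P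
does-true (yes p) _ = p

does-⇔ : ∀ {P Q : Set} (x : Dec P) (y : Dec Q) → (P → Q) → (Q → P) → does x ≡ does y
does-⇔ (yes p) y p⇒q q⇒p = sym (dec-true y (p⇒q p))
does-⇔ (no ¬p) y p⇒q q⇒p = sym (dec-false y (¬p ∘ q⇒p))

sumℚ-++ : ∀ xs ys → sumℚ (xs ++ ys) ≡ sumℚ xs + sumℚ ys
sumℚ-++ []       ys = sym (ℚP.+-identityˡ _)
sumℚ-++ (x ∷ xs) ys rewrite sumℚ-++ xs ys = sym (ℚP.+-assoc x _ _)

sumℚ-nonneg : ∀ xs → NonNeg xs → 0ℚ ≤ sumℚ xs
sumℚ-nonneg []       []         = ℚP.≤-refl
sumℚ-nonneg (x ∷ xs) (x≥0 ∷ ps) = ℚP.+-mono-≤ x≥0 (sumℚ-nonneg xs ps)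

sumℚ-pos : ∀ xs → Positive xs → null xs ≡ false → 0ℚ < sumℚ xs
sumℚ-pos (x ∷ xs) (x>0 ∷ xs>0) _ = ℚP.<-≤-trans x>0 (≤-+-nonnegʳ x (sumℚ-nonneg xs (All.map ℚP.<⇒≤ xs>0)))

at-++ˡ : ∀ xs ys t → t ℕ.< length xs → at (xs ++ ys) t ≡ at xs t
at-++ˡ (x ∷ xs) ys zero    _          = refl
at-++ˡ (x ∷ xs) ys (suc t) (ℕ.s≤s lt) = at-++ˡ xs ys t lt

at-++ʳ : ∀ xs ys t → at (xs ++ ys) (length xs ℕ.+ t) ≡ at ys t
at-++ʳ []       ys t = refl
at-++ʳ (x ∷ xs) ys t = at-++ʳ xs ys t

at-middle : ∀ xs y ys → at (xs ++ y ∷ ys) (length xs) ≡ y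
at-middle []       y ys = refl
at-middle (x ∷ xs) y ys = at-middle xs y ys

at-beyond : ∀ xs t → length xs ℕ.≤ t → at xs t ≡ 0ℚ
at-beyond []       t       _          = refl
at-beyond (x ∷ xs) (suc t) (ℕ.s≤s le) = at-beyond xs t le

at-≤ : ∀ xs t {d} → 0ℚ ≤ d → All (_≤ d) xs → at xs t ≤ d
at-≤ []       t       d≥0 _        = d≥0
at-≤ (x ∷ xs) zero    d≥0 (p ∷ _)  = p
at-≤ (x ∷ xs) (suc t) d≥0 (_ ∷ ps) = at-≤ xs t d≥0 ps

at-nonneg : ∀ xs t → NonNeg xs → 0ℚ ≤ at xs t
at-nonneg []       t       _        = ℚP.≤-refl
at-nonneg (x ∷ xs) zero    (p ∷ _)  = p
at-nonneg (x ∷ xs) (suc t) (_ ∷ ps) = at-nonneg xs t ps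

gain-covered : ∀ d L → d ≤ L → gain d L ≡ d
gain-covered d L = if-yes (d ℚP.≤? L)

gain-uncovered : ∀ d L → L < d → gain d L ≡ 0ℚ
gain-uncovered d L L<d = if-no (d ℚP.≤? L) (<⇒≱ L<d)

gain-≤ : ∀ d L → 0ℚ ≤ d → gain d L ≤ d
gain-≤ d L d≥0 with d ℚP.≤? L
... | yes d≤L = ℚP.≤-reflexive (gain-covered d L d≤L)
... | no  d≰L = subst (_≤ d) (sym (gain-uncovered d L (ℚP.≰⇒> d≰L))) d≥0

gain-nonneg : ∀ d L → 0ℚ ≤ d → 0ℚ ≤ gain d L
gain-nonneg d L d≥0 with d ℚP.≤? L
... | yes d≤L = subst (0ℚ ≤_) (sym (gain-covered d L d≤L)) d≥0
... | no  d≰L = ℚP.≤-reflexive (sym (gain-uncovered d L (ℚP.≰⇒> d≰L)))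

gain-mono : ∀ d {L L'} → 0ℚ ≤ d → L ≤ L' → gain d L ≤ gain d L'
gain-mono d {L} {L'} d≥0 L≤L' with d ℚP.≤? L
... | yes d≤L = ℚP.≤-reflexive (trans (gain-covered d L d≤L) (sym (gain-covered d L' (ℚP.≤-trans d≤L L≤L'))))
... | no  d≰L = subst (_≤ gain d L') (sym (gain-uncovered d L (ℚP.≰⇒> d≰L))) (gain-nonneg d L' d≥0)

-- An assignment lists the items (by size, in order) together with the
-- 0-based index of the bin receiving each item, or nothing.

Assignment : Set
Assignment = List (ℚ × Maybe ℕ)

sizes : Assignment → List ℚ
sizes = map proj₁

split-assignment : ∀ Q s T a → sizes a ≡ Q ++ s ∷ T →
  ∃[ aQ ] ∃[ l ] ∃[ aT ] (a ≡ aQ ++ (s , l) ∷ aT × sizes aQ ≡ Q × sizes aT ≡ T)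
split-assignment []      s T ((s' , l) ∷ aT) eq with ListP.∷-injective eq
... | refl , aT-items = [] , l , aT , refl , refl , aT-items
split-assignment (q ∷ Q) s T ((q' , l') ∷ a) eq with ListP.∷-injective eq
... | refl , rest with split-assignment Q s T a rest
...   | aQ , l , aT , refl , aQ-items , aT-items = (q , l') ∷ aQ , l , aT , refl , cong (q ∷_) aQ-items , aT-items

isBin : ℕ → Maybe ℕ → Bool
isBin k nothing   = false
isBin k (just k') = does (k ℕ.≟ k')

isBin-self : ∀ k → isBin k (just k) ≡ true
isBin-self k = dec-true (k ℕ.≟ k) refl

isBin-≢ : ∀ {k k'} → k ≢ k' → isBin k (just k') ≡ false
isBin-≢ {k} {k'} = dec-false (k ℕ.≟ k')

isBin-unique : ∀ {i k} l → i ≢ k → isBin i l ≡ true → isBin k l ≡ false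
isBin-unique {i} nothing   i≢k ()
isBin-unique {i} (just k') i≢k eq with does-true (i ℕ.≟ k') eq
... | refl = isBin-≢ (λ k≡i → i≢k (sym k≡i))

loadWhere : (Maybe ℕ → Bool) → Assignment → ℚ
loadWhere p []            = 0ℚ
loadWhere p ((s , l) ∷ a) = (if p l then s else 0ℚ) + loadWhere p a

loadAt : ℕ → Assignment → ℚ
loadAt k = loadWhere (isBin k)

loads : Assignment → ℕ → ℚ
loads a k = loadAt k a

loadWhere-++ : ∀ p a b → loadWhere p (a ++ b) ≡ loadWhere p a + loadWhere p b
loadWhere-++ p []            b = sym (ℚP.+-identityˡ _)
loadWhere-++ p ((s , l) ∷ a) b rewrite loadWhere-++ p a b =
  sym (ℚP.+-assoc (if p l then s else 0ℚ) (loadWhere p a) (loadWhere p b))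

loadWhere-nonneg : ∀ p a → NonNeg (sizes a) → 0ℚ ≤ loadWhere p a
loadWhere-nonneg p []            _          = ℚP.≤-refl
loadWhere-nonneg p ((s , l) ∷ a) (s≥0 ∷ ps) = ℚP.+-mono-≤ (part (p l)) (loadWhere-nonneg p a ps)
  where
  part : ∀ b → 0ℚ ≤ (if b then s else 0ℚ)
  part true  = s≥0
  part false = ℚP.≤-refl

loadWhere-≤-total : ∀ p a → NonNeg (sizes a) → loadWhere p a ≤ sumℚ (sizes a)
loadWhere-≤-total p []            _          = ℚP.≤-refl
loadWhere-≤-total p ((s , l) ∷ a) (s≥0 ∷ ps) = ℚP.+-mono-≤ (part (p l)) (loadWhere-≤-total p a ps)
  where
  part : ∀ b → (if b then s else 0ℚ) ≤ s
  part true  = ℚP.≤-refl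
  part false = s≥0

loadWhere-cong : ∀ {p q} a → (∀ l → p l ≡ q l) → loadWhere p a ≡ loadWhere q a
loadWhere-cong []            p≗q = refl
loadWhere-cong ((s , l) ∷ a) p≗q =
  cong₂ (λ b r → (if b then s else 0ℚ) + r) (p≗q l) (loadWhere-cong a p≗q)

loadWhere-absent : ∀ {p} a → All (λ x → p (proj₂ x) ≡ false) a → loadWhere p a ≡ 0ℚ
loadWhere-absent []            []        = refl
loadWhere-absent ((s , l) ∷ a) (pl ∷ ps) rewrite pl = trans (ℚP.+-identityˡ _) (loadWhere-absent a ps)

loadWhere-none : ∀ {p} a → (∀ l → p l ≡ false) → loadWhere p a ≡ 0ℚ
loadWhere-none a p≗false = loadWhere-absent a (All.universal (p≗false ∘ proj₂) a)

loadWhere-∨ : ∀ p q a → (∀ l → p l ≡ true → q l ≡ false) →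
              loadWhere (λ l → p l ∨ q l) a ≡ loadWhere p a + loadWhere q a
loadWhere-∨ p q []            disj = sym (ℚP.+-identityˡ 0ℚ)
loadWhere-∨ p q ((s , l) ∷ a) disj =
  trans (cong₂ _+_ (split (p l) (q l) (disj l)) (loadWhere-∨ p q a disj))
        (solve 4 (λ w x y z → (w :+ x) :+ (y :+ z) := (w :+ y) :+ (x :+ z)) refl
                 (if p l then s else 0ℚ) (if q l then s else 0ℚ) (loadWhere p a) (loadWhere q a))
  where
  split : ∀ b c → (b ≡ true → c ≡ false) →
          (if b ∨ c then s else 0ℚ) ≡ (if b then s else 0ℚ) + (if c then s else 0ℚ)
  split true  c     b⇒¬c rewrite b⇒¬c refl = sym (ℚP.+-identityʳ s)
  split false true  _    = sym (ℚP.+-identityˡ s)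
  split false false _    = sym (ℚP.+-identityˡ 0ℚ)

relabel : (ℕ → Maybe ℕ) → Assignment → Assignment
relabel f = map (λ (s , l) → s , (l >>= f))

sizes-relabel : ∀ f a → sizes (relabel f a) ≡ sizes a
sizes-relabel f []      = refl
sizes-relabel f (x ∷ a) = cong (proj₁ x ∷_) (sizes-relabel f a)

loadWhere-relabel : ∀ p f a → loadWhere p (relabel f a) ≡ loadWhere (λ l → p (l >>= f)) a
loadWhere-relabel p f []            = refl
loadWhere-relabel p f ((s , l) ∷ a) = cong ((if p (l >>= f) then s else 0ℚ) +_) (loadWhere-relabel p f a)

redirect : ℕ → Maybe ℕ → ℕ → Maybe ℕ
redirect i t k' = if isBin i (just k') then t else just k'

loadAt-redirect : ∀ i t k a →
  loadAt k (relabel (redirect i t) a) ≡ loadWhere (λ l → if isBin i l then isBin k t else isBin k l) a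
loadAt-redirect i t k a = trans (loadWhere-relabel (isBin k) (redirect i t) a) (loadWhere-cong a pointwise)
  where
  pointwise : ∀ l → isBin k (l >>= redirect i t) ≡ (if isBin i l then isBin k t else isBin k l)
  pointwise nothing   = refl
  pointwise (just k') = if-float (isBin k) (isBin i (just k'))

loadAt-redirect-other : ∀ i t k a → k ≢ i → isBin k t ≡ false →
                        loadAt k (relabel (redirect i t) a) ≡ loadAt k a
loadAt-redirect-other i t k a k≢i kt = trans (loadAt-redirect i t k a) (loadWhere-cong a pointwise)
  where
  pointwise : ∀ l → (if isBin i l then isBin k t else isBin k l) ≡ isBin k l
  pointwise l with isBin i l in il
  ... | true  = trans kt (sym (isBin-unique l (λ i≡k → k≢i (sym i≡k)) il))
  ... | false = refl

loadAt-redirect-source : ∀ i t a → isBin i t ≡ false → loadAt i (relabel (redirect i t) a) ≡ 0ℚ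
loadAt-redirect-source i t a it = trans (loadAt-redirect i t i a) (loadWhere-none a pointwise)
  where
  pointwise : ∀ l → (if isBin i l then isBin i t else isBin i l) ≡ false
  pointwise l with isBin i l in il
  ... | true  = it
  ... | false = refl

loadAt-redirect-target : ∀ i t k a → k ≢ i → isBin k t ≡ true →
                         loadAt k (relabel (redirect i t) a) ≡ loadAt k a + loadAt i a
loadAt-redirect-target i t k a k≢i kt =
  trans (loadAt-redirect i t k a)
        (trans (loadWhere-cong a pointwise) (loadWhere-∨ (isBin k) (isBin i) a (λ l → isBin-unique l k≢i)))
  where
  pointwise : ∀ l → (if isBin i l then isBin k t else isBin k l) ≡ (isBin k l ∨ isBin i l)
  pointwise l with isBin i l in il | isBin k l
  ... | true  | true  = kt
  ... | true  | false = kt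
  ... | false | kl    = sym (∨-identityʳ kl)

-- Deleting bin i: bins above i move down by one, items of bin i become
-- unassigned.  punchIn i k is the old index of the new bin k.

punchIn : ℕ → ℕ → ℕ
punchIn zero    k       = suc k
punchIn (suc i) zero    = zero
punchIn (suc i) (suc k) = suc (punchIn i k)

deleteBin : ℕ → ℕ → Maybe ℕ
deleteBin zero    zero    = nothing
deleteBin zero    (suc k) = just k
deleteBin (suc i) zero    = just zero
deleteBin (suc i) (suc k) = Maybe.map suc (deleteBin i k)

loadAt-deleteBin : ∀ i k a → loadAt k (relabel (deleteBin i) a) ≡ loadAt (punchIn i k) a
loadAt-deleteBin i k a = trans (loadWhere-relabel (isBin k) (deleteBin i) a) (loadWhere-cong a (pointwise i k))
  where
  isBin-map-suc : ∀ k x → isBin (suc k) (Maybe.map suc x) ≡ isBin k x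
  isBin-map-suc k nothing  = refl
  isBin-map-suc k (just _) = refl
  isBin-zero-map-suc : ∀ x → isBin zero (Maybe.map suc x) ≡ false
  isBin-zero-map-suc nothing  = refl
  isBin-zero-map-suc (just _) = refl
  pointwise : ∀ i k l → isBin k (l >>= deleteBin i) ≡ isBin (punchIn i k) l
  pointwise i       k       nothing         = refl
  pointwise zero    k       (just zero)     = refl
  pointwise zero    k       (just (suc k')) = refl
  pointwise (suc i) zero    (just zero)     = refl
  pointwise (suc i) (suc k) (just zero)     = refl
  pointwise (suc i) zero    (just (suc k')) = isBin-zero-map-suc (deleteBin i k')
  pointwise (suc i) (suc k) (just (suc k')) = trans (isBin-map-suc k (deleteBin i k')) (pointwise i k (just k'))

coverProfit : List ℚ → (ℕ → ℚ) → ℚ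
coverProfit []       L = 0ℚ
coverProfit (d ∷ ds) L = gain d (L 0) + coverProfit ds (L ∘ suc)

coverProfit-cong : ∀ ds L L' → (∀ t → t ℕ.< length ds → L t ≡ L' t) → coverProfit ds L ≡ coverProfit ds L'
coverProfit-cong []       L L' L≗L' = refl
coverProfit-cong (d ∷ ds) L L' L≗L' =
  cong₂ _+_ (cong (gain d) (L≗L' 0 (ℕ.s≤s ℕ.z≤n)))
            (coverProfit-cong ds (L ∘ suc) (L' ∘ suc) (λ t lt → L≗L' (suc t) (ℕ.s≤s lt)))

coverProfit-mono : ∀ ds L L' → (∀ t → t ℕ.< length ds → gain (at ds t) (L t) ≤ gain (at ds t) (L' t)) →
                   coverProfit ds L ≤ coverProfit ds L'
coverProfit-mono []       L L' le = ℚP.≤-refl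
coverProfit-mono (d ∷ ds) L L' le =
  ℚP.+-mono-≤ (le 0 (ℕ.s≤s ℕ.z≤n)) (coverProfit-mono ds (L ∘ suc) (L' ∘ suc) (λ t lt → le (suc t) (ℕ.s≤s lt)))

coverProfit-≤-except : ∀ ds L L' j e → 0ℚ ≤ e →
  (∀ t → t ℕ.< length ds → t ≢ j → gain (at ds t) (L t) ≤ gain (at ds t) (L' t)) →
  gain (at ds j) (L j) ≤ gain (at ds j) (L' j) + e →
  coverProfit ds L ≤ coverProfit ds L' + e
coverProfit-≤-except []       L L' j e e≥0 le le-j = subst (0ℚ ≤_) (sym (ℚP.+-identityˡ e)) e≥0
coverProfit-≤-except (d ∷ ds) L L' zero e e≥0 le le-j = begin
  gain d (L 0) + coverProfit ds (L ∘ suc)         ≤⟨ ℚP.+-mono-≤ le-j (coverProfit-mono ds (L ∘ suc) (L' ∘ suc) rest) ⟩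
  (gain d (L' 0) + e) + coverProfit ds (L' ∘ suc) ≡⟨ ℚP.+-assoc (gain d (L' 0)) e _ ⟩
  gain d (L' 0) + (e + coverProfit ds (L' ∘ suc)) ≡⟨ cong (gain d (L' 0) +_) (ℚP.+-comm e _) ⟩
  gain d (L' 0) + (coverProfit ds (L' ∘ suc) + e) ≡⟨ sym (ℚP.+-assoc (gain d (L' 0)) _ e) ⟩
  gain d (L' 0) + coverProfit ds (L' ∘ suc) + e   ∎
  where
  open ℚP.≤-Reasoning
  rest : ∀ t → t ℕ.< length ds → gain (at ds t) (L (suc t)) ≤ gain (at ds t) (L' (suc t))
  rest t lt = le (suc t) (ℕ.s≤s lt) (λ ())
coverProfit-≤-except (d ∷ ds) L L' (suc j) e e≥0 le le-j = begin
  gain d (L 0) + coverProfit ds (L ∘ suc)          ≤⟨ ℚP.+-mono-≤ (le 0 (ℕ.s≤s ℕ.z≤n) (λ ())) IH ⟩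
  gain d (L' 0) + (coverProfit ds (L' ∘ suc) + e) ≡⟨ sym (ℚP.+-assoc (gain d (L' 0)) _ e) ⟩
  gain d (L' 0) + coverProfit ds (L' ∘ suc) + e    ∎
  where
  open ℚP.≤-Reasoning
  IH = coverProfit-≤-except ds (L ∘ suc) (L' ∘ suc) j e e≥0
         (λ t lt t≢j → le (suc t) (ℕ.s≤s lt) (λ eq → t≢j (ℕP.suc-injective eq))) le-j

coverProfit-deleteBin : ∀ P d S L →
  coverProfit (P ++ d ∷ S) L ≡ coverProfit (P ++ S) (L ∘ punchIn (length P)) + gain d (L (length P))
coverProfit-deleteBin []      d S L = ℚP.+-comm (gain d (L 0)) _
coverProfit-deleteBin (p ∷ P) d S L =
  trans (cong (gain p (L 0) +_) (coverProfit-deleteBin P d S (L ∘ suc)))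
        (sym (ℚP.+-assoc (gain p (L 0)) _ _))

maxℚ : List ℚ → ℚ
maxℚ = foldr _⊔_ 0ℚ

maxℚ-ub : ∀ xs {x} → x ∈ xs → x ≤ maxℚ xs
maxℚ-ub (y ∷ xs) (here refl) = ℚP.p≤p⊔q y _
maxℚ-ub (y ∷ xs) (there x∈) = ℚP.≤-trans (maxℚ-ub xs x∈) (ℚP.p≤q⊔p y _)

maxℚ-lub : ∀ xs U → 0ℚ ≤ U → (∀ {x} → x ∈ xs → x ≤ U) → maxℚ xs ≤ U
maxℚ-lub []       U U≥0 ub = U≥0
maxℚ-lub (y ∷ xs) U U≥0 ub = ℚP.⊔-lub (ub (here refl)) (maxℚ-lub xs U U≥0 (ub ∘ there))

allAssign-complete : ∀ m ss a → map proj₁ a ≡ ss → a ∈ allAssign m ss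
allAssign-complete m []       []            refl = here refl
allAssign-complete m (s ∷ ss) ((.s , t) ∷ a) refl =
  ∈-concatMap⁺ _ (lose (allAssign-complete m ss a refl) (label∈ t))
  where
  label∈ : ∀ t → ((s , t) ∷ a) ∈ map (λ t → (s , t) ∷ a) (nothing ∷ map just (allFin m))
  label∈ nothing  = here refl
  label∈ (just k) = there (∈-map⁺ _ (∈-map⁺ just (∈-allFin k)))

allAssign-sound : ∀ m ss a → a ∈ allAssign m ss → map proj₁ a ≡ ss
allAssign-sound m []       a (here refl) = refl
allAssign-sound m (s ∷ ss) a a∈ with find (∈-concatMap⁻ _ {xs = allAssign m ss} a∈)
... | a' , a'∈ , a∈map with ∈-map⁻ _ a∈map
...   | t , _ , refl = cong (s ∷_) (allAssign-sound m ss a' a'∈)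

toℕLabels : ∀ {m} → List (ℚ × Maybe (Fin m)) → Assignment
toℕLabels = map (λ (s , t) → s , Maybe.map toℕ t)

sizes-toℕLabels : ∀ {m} (a : List (ℚ × Maybe (Fin m))) → sizes (toℕLabels a) ≡ map proj₁ a
sizes-toℕLabels []      = refl
sizes-toℕLabels (x ∷ a) = cong (proj₁ x ∷_) (sizes-toℕLabels a)

load-toℕLabels : ∀ {m} (k : Fin m) a → load k a ≡ loadAt (toℕ k) (toℕLabels a)
load-toℕLabels k []                  = refl
load-toℕLabels k ((s , nothing) ∷ a) = trans (load-toℕLabels k a) (sym (ℚP.+-identityˡ _))
load-toℕLabels k ((s , just k') ∷ a) =
  trans (if-+ (does (k Fin.≟ k')) (load-toℕLabels k a))
        (cong (λ b → (if b then s else 0ℚ) + loadAt (toℕ k) (toℕLabels a))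
              (does-⇔ (k Fin.≟ k') (toℕ k ℕ.≟ toℕ k') (cong toℕ) FinP.toℕ-injective))
  where
  if-+ : ∀ b {x y} → x ≡ y → (if b then s + x else x) ≡ (if b then s else 0ℚ) + y
  if-+ true  refl = refl
  if-+ false refl = sym (ℚP.+-identityˡ _)

profit-coverProfit : ∀ ds a → profit ds a ≡ coverProfit ds (loads (toℕLabels a))
profit-coverProfit ds a =
  trans (cong sumℚ (ListP.map-tabulate (λ k → k) (λ k → gain (lookup ds k) (load k a))))
        (tabulated ds (λ k → load k a) (loads (toℕLabels a)) (λ k → load-toℕLabels k a))
  where
  tabulated : ∀ ds (H : Fin (length ds) → ℚ) (H' : ℕ → ℚ) → (∀ k → H k ≡ H' (toℕ k)) →
              sumℚ (tabulate (λ k → gain (lookup ds k) (H k))) ≡ coverProfit ds H'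
  tabulated []       H H' H≗H' = refl
  tabulated (d ∷ ds) H H' H≗H' =
    cong₂ _+_ (cong (gain d) (H≗H' Fin.zero)) (tabulated ds (H ∘ Fin.suc) (H' ∘ suc) (H≗H' ∘ Fin.suc))

-- Conversely ℕ labels become Fin labels; labels beyond the last bin are
-- dropped, which does not affect the loads of the existing bins.
toFin : ∀ m → ℕ → Maybe (Fin m)
toFin m k with k ℕ.<? m
... | yes k<m = just (fromℕ< k<m)
... | no  _   = nothing

fromℕLabels : ∀ m → Assignment → List (ℚ × Maybe (Fin m))
fromℕLabels m = map (λ (s , l) → s , (l >>= toFin m))

sizes-fromℕLabels : ∀ m b → map proj₁ (fromℕLabels m b) ≡ sizes b
sizes-fromℕLabels m []      = refl
sizes-fromℕLabels m (x ∷ b) = cong (proj₁ x ∷_) (sizes-fromℕLabels m b)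

loadAt-roundtrip : ∀ m k b → k ℕ.< m → loadAt k (toℕLabels (fromℕLabels m b)) ≡ loadAt k b
loadAt-roundtrip m k []            k<m = refl
loadAt-roundtrip m k ((s , l) ∷ b) k<m =
  cong₂ (λ c r → (if c then s else 0ℚ) + r) (label l) (loadAt-roundtrip m k b k<m)
  where
  label : ∀ l → isBin k (Maybe.map toℕ (l >>= toFin m)) ≡ isBin k l
  label nothing = refl
  label (just k') with k' ℕ.<? m
  ... | yes k'<m = cong (isBin k ∘ just) (FinP.toℕ-fromℕ< k'<m)
  ... | no  k'≮m = sym (isBin-≢ {k} {k'} (λ { refl → k'≮m k<m }))

OPT-≥ : ∀ ds ss b → sizes b ≡ ss → coverProfit ds (loads b) ≤ OPT ds ss
OPT-≥ ds ss b b-items =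
  ℚP.≤-trans (ℚP.≤-reflexive (trans (coverProfit-cong ds _ _ (λ t t< → sym (loadAt-roundtrip (length ds) t b t<)))
                                    (sym (profit-coverProfit ds a))))
             (maxℚ-ub _ (∈-map⁺ (profit ds) (allAssign-complete (length ds) ss a (trans (sizes-fromℕLabels _ b) b-items))))
  where a = fromℕLabels (length ds) b

OPT-≤ : ∀ ds ss U → 0ℚ ≤ U → (∀ b → sizes b ≡ ss → coverProfit ds (loads b) ≤ U) → OPT ds ss ≤ U
OPT-≤ ds ss U U≥0 bound = maxℚ-lub _ U U≥0 (λ x∈ → each (∈-map⁻ (profit ds) x∈))
  where
  each : ∀ {x} → ∃ (λ a → a ∈ allAssign (length ds) ss × x ≡ profit ds a) → x ≤ U
  each (a , a∈ , refl) =
    ℚP.≤-trans (ℚP.≤-reflexive (profit-coverProfit ds a))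
               (bound (toℕLabels a) (trans (sizes-toℕLabels a) (allAssign-sound _ ss a a∈)))

OPT-nonneg : ∀ ds ss → 0ℚ ≤ OPT ds ss
OPT-nonneg ds ss = lower (map (profit ds) (allAssign (length ds) ss))
  where
  lower : ∀ xs → 0ℚ ≤ maxℚ xs
  lower []       = ℚP.≤-refl
  lower (y ∷ xs) = ℚP.≤-trans (lower xs) (ℚP.p≤q⊔p y _)

residual-pos : ∀ d x → ¬ d ≤ x → 0ℚ < d - x
residual-pos d x d≰x =
  subst (_< d - x) (solve 1 (λ x → x :- x := con 0ℚ) refl x) (ℚP.+-monoˡ-< (-_ x) (ℚP.≰⇒> d≰x))

residual-≤ : ∀ d x b → d ≤ x + b → d - x ≤ b
residual-≤ d x b d≤x+b =
  ℚP.≤-trans (ℚP.+-monoˡ-≤ (-_ x) d≤x+b) (ℚP.≤-reflexive (solve 2 (λ x b → (x :+ b) :- x := b) refl x b))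

residual-≥ : ∀ d x b → d - x ≤ b → d ≤ x + b
residual-≥ d x b d-x≤b =
  ℚP.≤-trans (ℚP.≤-reflexive (solve 2 (λ d x → d := x :+ (d :- x)) refl d x)) (ℚP.+-monoʳ-≤ x d-x≤b)

takeCover-fits : ∀ d x xs → d ≤ x → takeCover d (x ∷ xs) ≡ ([ x ] , xs)
takeCover-fits d x xs = if-yes (d ℚP.≤? x)

takeCover-continues : ∀ d x xs → ¬ d ≤ x →
  takeCover d (x ∷ xs) ≡ (x ∷ proj₁ (takeCover (d - x) xs) , proj₂ (takeCover (d - x) xs))
takeCover-continues d x xs = if-no (d ℚP.≤? x)

takeCover-split : ∀ d R → R ≡ proj₁ (takeCover d R) ++ proj₂ (takeCover d R)
takeCover-split d []       = refl
takeCover-split d (x ∷ xs) with d ℚP.≤? x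
... | yes d≤x rewrite takeCover-fits d x xs d≤x = refl
... | no  d≰x rewrite takeCover-continues d x xs d≰x = cong (x ∷_) (takeCover-split (d - x) xs)

takeCover-covers : ∀ d R → d ≤ sumℚ R → d ≤ sumℚ (proj₁ (takeCover d R))
takeCover-covers d []       d≤ = d≤
takeCover-covers d (x ∷ xs) d≤ with d ℚP.≤? x
... | yes d≤x rewrite takeCover-fits d x xs d≤x = subst (d ≤_) (sym (ℚP.+-identityʳ x)) d≤x
... | no  d≰x rewrite takeCover-continues d x xs d≰x =
  residual-≥ d x _ (takeCover-covers (d - x) xs (residual-≤ d x _ d≤))

takeCover-prefix : ∀ d R → 0ℚ < d → d ≤ sumℚ R → ∀ Z →
  takeCover d (proj₁ (takeCover d R) ++ Z) ≡ (proj₁ (takeCover d R) , Z)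
takeCover-prefix d []       d>0 d≤ Z = ⊥-elim (<⇒≱ d>0 d≤)
takeCover-prefix d (x ∷ xs) d>0 d≤ Z with d ℚP.≤? x
... | yes d≤x rewrite takeCover-fits d x xs d≤x = takeCover-fits d x Z d≤x
... | no  d≰x rewrite takeCover-continues d x xs d≰x =
  trans (takeCover-continues d x _ d≰x)
        (cong (λ r → (x ∷ proj₁ r , proj₂ r))
              (takeCover-prefix (d - x) xs (residual-pos d x d≰x) (residual-≤ d x _ d≤) Z))

takeCover-overshoot : ∀ M d xs → 0ℚ ≤ M → 0ℚ < d → All (_≤ M) xs → sumℚ (proj₁ (takeCover d xs)) < d + M
takeCover-overshoot M d []       M≥0 d>0 _ = ℚP.<-≤-trans d>0 (≤-+-nonnegʳ d M≥0)
takeCover-overshoot M d (x ∷ xs) M≥0 d>0 (x≤M ∷ xs≤M) with d ℚP.≤? x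
... | yes d≤x rewrite takeCover-fits d x xs d≤x =
  subst (_< d + M) (sym (ℚP.+-identityʳ x)) (ℚP.≤-<-trans x≤M (subst (_< d + M) (ℚP.+-identityˡ M) (ℚP.+-monoˡ-< M d>0)))
... | no  d≰x rewrite takeCover-continues d x xs d≰x =
  ℚP.<-≤-trans (ℚP.+-monoʳ-< x (takeCover-overshoot M (d - x) xs M≥0 (residual-pos d x d≰x) xs≤M))
               (ℚP.≤-reflexive (solve 3 (λ x d M → x :+ ((d :- x) :+ M) := d :+ M) refl x d M))

takeCover-single : ∀ d s rest → 0ℚ < d → 0ℚ ≤ s → All (_≤ s) rest →
  d + d ≤ sumℚ (proj₁ (takeCover d (s ∷ rest))) → takeCover d (s ∷ rest) ≡ ([ s ] , rest)
takeCover-single d s rest d>0 s≥0 rest≤s 2d≤ with d ℚP.≤? s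
... | yes d≤s = takeCover-fits d s rest d≤s
... | no  d≰s = ⊥-elim (<⇒≱ block<2d (subst (λ r → d + d ≤ sumℚ (proj₁ r)) (takeCover-continues d s rest d≰s) 2d≤))
  where
  block<2d : s + sumℚ (proj₁ (takeCover (d - s) rest)) < d + d
  block<2d = ℚP.<-trans
    (ℚP.<-≤-trans (ℚP.+-monoʳ-< s (takeCover-overshoot s (d - s) rest s≥0 (residual-pos d s d≰s) rest≤s))
                  (ℚP.≤-reflexive (solve 2 (λ s d → s :+ ((d :- s) :+ s) := d :+ s) refl s d)))
    (ℚP.+-monoʳ-< d (ℚP.≰⇒> d≰s))

blocks : List ℚ → List ℚ → List (List ℚ)
blocks ds ss = proj₁ (nfd ds ss)

leftover : List ℚ → List ℚ → List ℚ
leftover ds ss = proj₂ (nfd ds ss)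

blockLoad : List (List ℚ) → ℕ → ℚ
blockLoad Bs = at (map sumℚ Bs)

blockLoad-snoc-before : ∀ Cs B t → t ℕ.< length Cs → blockLoad (Cs ++ [ B ]) t ≡ blockLoad Cs t
blockLoad-snoc-before (C ∷ Cs) B zero    _          = refl
blockLoad-snoc-before (C ∷ Cs) B (suc t) (ℕ.s≤s t<) = blockLoad-snoc-before Cs B t t<

blockLoad-snoc-last : ∀ Cs B → blockLoad (Cs ++ [ B ]) (length Cs) ≡ sumℚ B
blockLoad-snoc-last []       B = refl
blockLoad-snoc-last (C ∷ Cs) B = blockLoad-snoc-last Cs B

nfd-skip : ∀ d ds W → sumℚ W < d → nfd (d ∷ ds) W ≡ ([] ∷ blocks ds W , leftover ds W)
nfd-skip d []        []       _ = refl
nfd-skip d (_ ∷ _)   []       _ = refl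
nfd-skip d ds        (x ∷ xs) W<d = if-yes (sumℚ (x ∷ xs) ℚP.<? d) W<d

nfd-fill : ∀ d ds W → 0ℚ < d → d ≤ sumℚ W →
  nfd (d ∷ ds) W ≡ (proj₁ (takeCover d W) ∷ blocks ds (proj₂ (takeCover d W)) , leftover ds (proj₂ (takeCover d W)))
nfd-fill d ds []       d>0 d≤ = ⊥-elim (<⇒≱ d>0 d≤)
nfd-fill d ds (x ∷ xs) d>0 d≤ = if-no (sumℚ (x ∷ xs) ℚP.<? d) (≤⇒≯ d≤)

nfd-fill-prefix : ∀ d ds R Z → 0ℚ < d → d ≤ sumℚ R → NonNeg Z →
  nfd (d ∷ ds) (proj₁ (takeCover d R) ++ Z) ≡ (proj₁ (takeCover d R) ∷ blocks ds Z , leftover ds Z)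
nfd-fill-prefix d ds R Z d>0 d≤ Z≥0 =
  trans (nfd-fill d ds (B ++ Z) d>0 d≤B++Z)
        (cong (λ r → proj₁ r ∷ blocks ds (proj₂ r) , leftover ds (proj₂ r)) (takeCover-prefix d R d>0 d≤ Z))
  where
  B = proj₁ (takeCover d R)
  d≤B++Z : d ≤ sumℚ (B ++ Z)
  d≤B++Z = ℚP.≤-trans (takeCover-covers d R d≤)
             (subst (sumℚ B ≤_) (sym (sumℚ-++ B Z)) (≤-+-nonnegʳ (sumℚ B) (sumℚ-nonneg Z Z≥0)))

data StepKind (d : ℚ) (R : List ℚ) : List ℚ → List ℚ → Set where
  skipped : sumℚ R < d → StepKind d R [] R
  filled  : ∀ {B R'} → d ≤ sumℚ R → takeCover d R ≡ (B , R') → StepKind d R B R'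

record NFDStep (d : ℚ) (ds R : List ℚ) : Set where
  constructor step
  field
    block rest : List ℚ
    unfold     : nfd (d ∷ ds) R ≡ (block ∷ blocks ds rest , leftover ds rest)
    split      : R ≡ block ++ rest
    kind       : StepKind d R block rest

nfdStep : ∀ d ds R → 0ℚ < d → NFDStep d ds R
nfdStep d ds R d>0 with sumℚ R ℚP.<? d
... | yes R<d = step [] R (nfd-skip d ds R R<d) refl (skipped R<d)
... | no  R≮d = step _ _ (nfd-fill d ds R d>0 (ℚP.≮⇒≥ R≮d)) (takeCover-split d R) (filled (ℚP.≮⇒≥ R≮d) refl)

nfd-items : ∀ ds R → Positive ds → R ≡ concat (blocks ds R) ++ leftover ds R
nfd-items []       R _            = refl
nfd-items (d ∷ ds) R (d>0 ∷ ds>0) with nfdStep d ds R d>0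
... | step B R' unfold R≡ _ rewrite unfold =
  trans R≡ (trans (cong (B ++_) (nfd-items ds R' ds>0)) (sym (ListP.++-assoc B _ _)))

nfd-length : ∀ ds R → Positive ds → length (blocks ds R) ≡ length ds
nfd-length []       R _            = refl
nfd-length (d ∷ ds) R (d>0 ∷ ds>0) with nfdStep d ds R d>0
... | step B R' unfold _ _ rewrite unfold = cong suc (nfd-length ds R' ds>0)

blocksProfit : List ℚ → List (List ℚ) → ℚ
blocksProfit ds Bs = sumℚ (zipWith (λ d b → gain d (sumℚ b)) ds Bs)

blocksProfit-nonneg : ∀ ds Bs → Positive ds → 0ℚ ≤ blocksProfit ds Bs
blocksProfit-nonneg []       Bs       _            = ℚP.≤-refl
blocksProfit-nonneg (d ∷ ds) []       _            = ℚP.≤-refl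
blocksProfit-nonneg (d ∷ ds) (B ∷ Bs) (d>0 ∷ ds>0) =
  ℚP.+-mono-≤ (gain-nonneg d (sumℚ B) (ℚP.<⇒≤ d>0)) (blocksProfit-nonneg ds Bs ds>0)

coverProfit-blocks : ∀ ds Bs → length Bs ≡ length ds → coverProfit ds (blockLoad Bs) ≡ blocksProfit ds Bs
coverProfit-blocks []       []       _   = refl
coverProfit-blocks (d ∷ ds) (B ∷ Bs) len = cong (gain d (sumℚ B) +_) (coverProfit-blocks ds Bs (ℕP.suc-injective len))

intoFirstBin : List ℚ → Assignment
intoFirstBin = map (λ s → s , just 0)

shiftUp : Assignment → Assignment
shiftUp = relabel (just ∘ suc)

blockLabels : List (List ℚ) → Assignment
blockLabels []       = []
blockLabels (C ∷ Cs) = intoFirstBin C ++ shiftUp (blockLabels Cs)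

sizes-blockLabels : ∀ Cs → sizes (blockLabels Cs) ≡ concat Cs
sizes-blockLabels []       = refl
sizes-blockLabels (C ∷ Cs) =
  trans (ListP.map-++ proj₁ (intoFirstBin C) _)
        (cong₂ _++_ (sizes-intoFirstBin C) (trans (sizes-relabel _ (blockLabels Cs)) (sizes-blockLabels Cs)))
  where
  sizes-intoFirstBin : ∀ C → sizes (intoFirstBin C) ≡ C
  sizes-intoFirstBin []      = refl
  sizes-intoFirstBin (x ∷ C) = cong (x ∷_) (sizes-intoFirstBin C)

loadAt-blockLabels : ∀ Cs t → loadAt t (blockLabels Cs) ≡ blockLoad Cs t
loadAt-blockLabels []       t       = refl
loadAt-blockLabels (C ∷ Cs) zero    =
  trans (loadWhere-++ (isBin 0) (intoFirstBin C) _)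
        (trans (cong₂ _+_ (first C) (trans (loadWhere-relabel (isBin 0) _ (blockLabels Cs)) (loadWhere-none (blockLabels Cs) notZero)))
               (ℚP.+-identityʳ (sumℚ C)))
  where
  first : ∀ C → loadAt 0 (intoFirstBin C) ≡ sumℚ C
  first []      = refl
  first (x ∷ C) = cong (x +_) (first C)
  notZero : ∀ l → isBin 0 (l >>= (just ∘ suc)) ≡ false
  notZero nothing  = refl
  notZero (just _) = refl
loadAt-blockLabels (C ∷ Cs) (suc t) =
  trans (loadWhere-++ (isBin (suc t)) (intoFirstBin C) _)
        (trans (cong₂ _+_ (others C) (trans (loadWhere-relabel (isBin (suc t)) _ (blockLabels Cs)) (loadWhere-cong (blockLabels Cs) shifted)))
               (trans (ℚP.+-identityˡ _) (loadAt-blockLabels Cs t)))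
  where
  others : ∀ C → loadAt (suc t) (intoFirstBin C) ≡ 0ℚ
  others []      = refl
  others (x ∷ C) = trans (ℚP.+-identityˡ _) (others C)
  shifted : ∀ l → isBin (suc t) (l >>= (just ∘ suc)) ≡ isBin t l
  shifted nothing  = refl
  shifted (just _) = refl

unassigned : List ℚ → Assignment
unassigned = map (λ s → s , nothing)

sizes-unassigned : ∀ L → sizes (unassigned L) ≡ L
sizes-unassigned []      = refl
sizes-unassigned (x ∷ L) = cong (x ∷_) (sizes-unassigned L)

loadAt-unassigned : ∀ k L → loadAt k (unassigned L) ≡ 0ℚ
loadAt-unassigned k []      = refl
loadAt-unassigned k (x ∷ L) = trans (ℚP.+-identityˡ _) (loadAt-unassigned k L)

-- NFD's solution is a feasible assignment, so NFD ≤ OPT.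
NFD≤OPT : ∀ ds R → Positive ds → NFD ds R ≤ OPT ds R
NFD≤OPT ds R ds>0 =
  ℚP.≤-trans (ℚP.≤-reflexive (trans (sym (coverProfit-blocks ds Bs (nfd-length ds R ds>0)))
                                    (coverProfit-cong ds _ _ (λ t _ → sym (b-loads t)))))
             (OPT-≥ ds R b b-items)
  where
  Bs = blocks ds R
  b  = blockLabels Bs ++ unassigned (leftover ds R)
  b-items : sizes b ≡ R
  b-items = trans (ListP.map-++ proj₁ (blockLabels Bs) _)
                  (trans (cong₂ _++_ (sizes-blockLabels Bs) (sizes-unassigned _)) (sym (nfd-items ds R ds>0)))
  b-loads : ∀ t → loadAt t b ≡ blockLoad Bs t
  b-loads t = trans (loadWhere-++ (isBin t) (blockLabels Bs) _)
                  (trans (cong₂ _+_ (loadAt-blockLabels Bs t) (loadAt-unassigned t (leftover ds R))) (ℚP.+-identityʳ _))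

NFD-zero : ∀ ds R → Positive ds → NFD ds R ≡ 0ℚ → All (λ d → sumℚ R < d) ds
NFD-zero []       R _            _ = []
NFD-zero (d ∷ ds) R (d>0 ∷ ds>0) NFD≡0 with nfdStep d ds R d>0
... | step B R' unfold _ kind rewrite unfold with kind
...   | skipped R<d = R<d ∷ NFD-zero ds R ds>0 (nonneg-sum-zeroʳ NFD≡0)
  where
  nonneg-sum-zeroʳ : gain d (sumℚ []) + NFD ds R ≡ 0ℚ → NFD ds R ≡ 0ℚ
  nonneg-sum-zeroʳ eq = ℚP.≤-antisym (subst (NFD ds R ≤_) eq (≤-+-nonnegˡ _ (gain-nonneg d 0ℚ (ℚP.<⇒≤ d>0))))
                                      (blocksProfit-nonneg ds _ ds>0)
...   | filled d≤R takeCover≡ = ⊥-elim (<⇒≱ d>0 d≤0)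
  where
  d≤B : d ≤ sumℚ B
  d≤B = subst (λ r → d ≤ sumℚ (proj₁ r)) takeCover≡ (takeCover-covers d R d≤R)
  d≤0 : d ≤ 0ℚ
  d≤0 = begin
    d                                          ≡⟨ sym (gain-covered d (sumℚ B) d≤B) ⟩
    gain d (sumℚ B)                            ≤⟨ ≤-+-nonnegʳ _ (blocksProfit-nonneg ds _ ds>0) ⟩
    gain d (sumℚ B) + NFD ds R'                ≡⟨ NFD≡0 ⟩
    0ℚ                                         ∎
    where open ℚP.≤-Reasoning

OPT-zero : ∀ ds R → NonNeg R → All (λ d → sumℚ R < d) ds → OPT ds R ≤ 0ℚ
OPT-zero ds R R≥0 R<ds = OPT-≤ ds R 0ℚ ℚP.≤-refl λ b b-items →
  ℚP.≤-reflexive (nothing-covered ds _ R<ds (λ k → subst (λ xs → loadAt k b ≤ sumℚ xs) b-items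
                                                    (loadWhere-≤-total (isBin k) b (subst NonNeg (sym b-items) R≥0))))
  where
  nothing-covered : ∀ ds (L : ℕ → ℚ) → All (λ d → sumℚ R < d) ds → (∀ k → L k ≤ sumℚ R) → coverProfit ds L ≡ 0ℚ
  nothing-covered []       L _            _   = refl
  nothing-covered (d ∷ ds) L (R<d ∷ R<ds) L≤R =
    trans (cong₂ _+_ (gain-uncovered d (L 0) (ℚP.≤-<-trans (L≤R 0) R<d)) (nothing-covered ds (L ∘ suc) R<ds (L≤R ∘ suc)))
          (ℚP.+-identityˡ 0ℚ)

at-after : ∀ P d S t → length P ℕ.< t → 0ℚ ≤ d → All (_≤ d) S → at (P ++ d ∷ S) t ≤ d
at-after P d S t P<t d≥0 S≤d with ℕP.m≤n⇒∃[o]m+o≡n P<t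
... | o , refl = subst (_≤ d) (sym (trans (cong (at (P ++ d ∷ S)) (sym (ℕP.+-suc (length P) o))) (at-++ʳ P (d ∷ S) (suc o))))
                       (at-≤ S o d≥0 S≤d)

gain-≤-+ : ∀ d L L' {e} → 0ℚ ≤ d → d ≤ e → gain d L ≤ gain d L' + e
gain-≤-+ d L L' d≥0 d≤e = ℚP.≤-trans (gain-≤ d L d≥0) (ℚP.≤-trans d≤e (≤-+-nonnegˡ _ (gain-nonneg d L' d≥0)))

coverProfit-emptied : ∀ P d S b → 0ℚ < d → loadAt (length P) b ≡ 0ℚ →
  coverProfit (P ++ d ∷ S) (loads b) ≡ coverProfit (P ++ S) (loads (relabel (deleteBin (length P)) b))
coverProfit-emptied P d S b d>0 empty =
  trans (coverProfit-deleteBin P d S (loads b))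
        (trans (cong₂ _+_ (coverProfit-cong (P ++ S) _ _ (λ t _ → sym (loadAt-deleteBin (length P) t b)))
                          (trans (cong (gain d) empty) (gain-uncovered d 0ℚ d>0)))
               (ℚP.+-identityʳ _))

record Replacement (X : List ℚ) (i : ℕ) (e : ℚ) (a : Assignment) (J' : List ℚ) : Set where
  constructor replacement
  field
    assignment : Assignment
    items      : sizes assignment ≡ J'
    empties    : loadAt i assignment ≡ 0ℚ
    loses-≤    : coverProfit X (loads a) ≤ coverProfit X (loads assignment) + e

-- a° is a with an item of size x taken out of bin c (other loads may shrink).
contribution : ℕ → ℚ → ℕ → ℚ
contribution k x c = if isBin k (just c) then x else 0ℚ

LosesItem : Assignment → Assignment → ℚ → ℕ → Set
LosesItem a a° x c = ∀ k → loadAt k a ≤ loadAt k a° + contribution k x c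

losesItem-elsewhere : ∀ a a° x c k → LosesItem a a° x c → k ≢ c → loadAt k a ≤ loadAt k a°
losesItem-elsewhere a a° x c k loses k≢c =
  ℚP.≤-trans (loses k) (ℚP.≤-reflexive (trans (cong (λ b → loadAt k a° + (if b then x else 0ℚ)) (isBin-≢ k≢c))
                                              (ℚP.+-identityʳ _)))

CoveredOrHopeless : List ℚ → List (List ℚ) → ℚ → Set
CoveredOrHopeless P Cs total =
  length Cs ≡ length P × (∀ t → t ℕ.< length P → at P t ≤ blockLoad Cs t ⊎ total < at P t)

High : ℕ → Maybe ℕ → Set
High i nothing  = ⊥
High i (just c) = i ℕ.≤ c

high? : ∀ i l → Dec (High i l)
high? i nothing  = no (λ ())
high? i (just c) = i ℕ.≤? c

module _ (P : List ℚ) (d : ℚ) (S : List ℚ) (d>0 : 0ℚ < d) (X≥0 : NonNeg (P ++ d ∷ S)) where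

  private
    i = length P
    X = P ++ d ∷ S
    d≥0 = ℚP.<⇒≤ d>0
    at≥0 : ∀ t → 0ℚ ≤ at X t
    at≥0 t = at-nonneg X t X≥0
    at-i : at X i ≡ d
    at-i = at-middle P d S

  resolve-at-removed : ∀ a a° x → LosesItem a a° x i → Replacement X i d a (sizes a°)
  resolve-at-removed a a° x loses =
    replacement b (sizes-relabel _ a°) (loadAt-redirect-source i nothing a° refl)
      (coverProfit-≤-except X (loads a) (loads b) i d d≥0
        (λ t _ t≢i → gain-mono (at X t) (at≥0 t)
                       (ℚP.≤-trans (losesItem-elsewhere a a° x i t loses t≢i)
                                   (ℚP.≤-reflexive (sym (loadAt-redirect-other i nothing t a° t≢i refl)))))
        (gain-≤-+ (at X i) (loadAt i a) (loadAt i b) (at≥0 i) (ℚP.≤-reflexive at-i)))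
    where b = relabel (redirect i nothing) a°

  -- If it was in a later bin c (demand ≤ d), move the contents of bin i
  -- into bin c: either bin i was covered, and then so is bin c, or bin i
  -- gained nothing and only bin c may lose its demand.
  resolve-by-merging : ∀ a a° x c → i ℕ.< c → All (_≤ d) S → NonNeg (sizes a°) → LosesItem a a° x c →
                       Replacement X i d a (sizes a°)
  resolve-by-merging a a° x c i<c S≤d a°≥0 loses =
    replacement b (sizes-relabel _ a°) (loadAt-redirect-source i (just c) a° (isBin-≢ i≢c)) bounded-loss
    where
    b = relabel (redirect i (just c)) a°
    i≢c : i ≢ c
    i≢c = ℕP.<⇒≢ i<c
    c≢i : c ≢ i
    c≢i = i≢c ∘ sym
    at-c≤d : at X c ≤ d
    at-c≤d = at-after P d S c i<c d≥0 S≤d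
    elsewhere : ∀ t → t ≢ i → t ≢ c → loadAt t a ≤ loadAt t b
    elsewhere t t≢i t≢c = ℚP.≤-trans (losesItem-elsewhere a a° x c t loses t≢c)
                            (ℚP.≤-reflexive (sym (loadAt-redirect-other i (just c) t a° t≢i (isBin-≢ t≢c))))
    at-c : loadAt i a ≤ loadAt c b
    at-c = begin
      loadAt i a                   ≤⟨ losesItem-elsewhere a a° x c i loses i≢c ⟩
      loadAt i a°                  ≤⟨ ≤-+-nonnegˡ _ (loadWhere-nonneg (isBin c) a° a°≥0) ⟩
      loadAt c a° + loadAt i a°    ≡⟨ sym (loadAt-redirect-target i (just c) c a° c≢i (isBin-self c)) ⟩
      loadAt c b                   ∎
      where open ℚP.≤-Reasoning
    bounded-loss : coverProfit X (loads a) ≤ coverProfit X (loads b) + d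
    bounded-loss with d ℚP.≤? loadAt i a
    ... | yes d≤Li = coverProfit-≤-except X (loads a) (loads b) i d d≥0 others
                       (gain-≤-+ (at X i) (loadAt i a) (loadAt i b) (at≥0 i) (ℚP.≤-reflexive at-i))
      where
      others : ∀ t → t ℕ.< length X → t ≢ i → gain (at X t) (loadAt t a) ≤ gain (at X t) (loadAt t b)
      others t _ t≢i with t ℕ.≟ c
      ... | yes refl = ℚP.≤-trans (gain-≤ (at X t) (loadAt t a) (at≥0 t))
                         (ℚP.≤-reflexive (sym (gain-covered (at X t) (loadAt t b) (ℚP.≤-trans at-c≤d (ℚP.≤-trans d≤Li at-c)))))
      ... | no  t≢c  = gain-mono (at X t) (at≥0 t) (elsewhere t t≢i t≢c)
    ... | no  d≰Li = coverProfit-≤-except X (loads a) (loads b) c d d≥0 others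
                       (gain-≤-+ (at X c) (loadAt c a) (loadAt c b) (at≥0 c) at-c≤d)
      where
      others : ∀ t → t ℕ.< length X → t ≢ c → gain (at X t) (loadAt t a) ≤ gain (at X t) (loadAt t b)
      others t _ t≢c with t ℕ.≟ i
      ... | yes refl = subst (_≤ gain (at X t) (loadAt t b))
                             (sym (gain-uncovered (at X t) (loadAt t a) (subst (loadAt t a <_) (sym at-i) (ℚP.≰⇒> d≰Li))))
                             (gain-nonneg (at X t) (loadAt t b) (at≥0 t))
      ... | no  t≢i  = gain-mono (at X t) (at≥0 t) (elsewhere t t≢i t≢c)

  resolve-high : ∀ a a° x c → i ℕ.≤ c → All (_≤ d) S → NonNeg (sizes a°) → LosesItem a a° x c →
                 Replacement X i d a (sizes a°)
  resolve-high a a° x c i≤c S≤d a°≥0 loses with ℕP.m≤n⇒m<n∨m≡n i≤c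
  ... | inj₁ i<c  = resolve-by-merging a a° x c i<c S≤d a°≥0 loses
  ... | inj₂ refl = resolve-at-removed a a° x loses

  low-above : ∀ t l → i ℕ.< t → ¬ High i l → isBin t l ≡ false
  low-above t nothing  i<t _    = refl
  low-above t (just c) i<t ¬i≤c = isBin-≢ {t} {c} (λ { refl → ¬i≤c (ℕP.<⇒≤ i<t) })

  loadAt-low-above : ∀ t aQ s l aT → i ℕ.< t → All (λ x → ¬ High i (proj₂ x)) aQ → ¬ High i l →
                     loadAt t (aQ ++ (s , l) ∷ aT) ≡ loadAt t aT
  loadAt-low-above t aQ s l aT i<t aQ-low l-low = begin
    loadAt t (aQ ++ (s , l) ∷ aT)                               ≡⟨ loadWhere-++ (isBin t) aQ _ ⟩
    loadAt t aQ + ((if isBin t l then s else 0ℚ) + loadAt t aT) ≡⟨ cong₂ (λ x c → x + ((if c then s else 0ℚ) + loadAt t aT))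
                                                                          aQ-absent (low-above t l i<t l-low) ⟩
    0ℚ + (0ℚ + loadAt t aT)                                     ≡⟨ trans (ℚP.+-identityˡ _) (ℚP.+-identityˡ _) ⟩
    loadAt t aT                                                 ∎
    where
    open ≡-Reasoning
    aQ-absent : loadAt t aQ ≡ 0ℚ
    aQ-absent = loadWhere-absent aQ (All.map (λ {x} → low-above t (proj₂ x) i<t) aQ-low)

  blocksThen : List (List ℚ) → Assignment → Assignment
  blocksThen Cs aT = blockLabels Cs ++ relabel (redirect i nothing) aT

  loadAt-blocksThen : ∀ Cs aT t → loadAt t (blocksThen Cs aT) ≡ blockLoad Cs t + loadAt t (relabel (redirect i nothing) aT)
  loadAt-blocksThen Cs aT t = trans (loadWhere-++ (isBin t) (blockLabels Cs) _) (cong (_+ _) (loadAt-blockLabels Cs t))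

  blocksThen-below : ∀ Cs aT t → NonNeg (sizes aT) → blockLoad Cs t ≤ loadAt t (blocksThen Cs aT)
  blocksThen-below Cs aT t aT≥0 =
    ℚP.≤-trans (≤-+-nonnegʳ _ (loadWhere-nonneg (isBin t) _ (subst NonNeg (sym (sizes-relabel _ aT)) aT≥0)))
               (ℚP.≤-reflexive (sym (loadAt-blocksThen Cs aT t)))

  blocksThen-from : ∀ Cs aT t → length Cs ≡ i → i ℕ.≤ t →
                    loadAt t (blocksThen Cs aT) ≡ loadAt t (relabel (redirect i nothing) aT)
  blocksThen-from Cs aT t lengths i≤t =
    trans (loadAt-blocksThen Cs aT t)
          (trans (cong (_+ _) (at-beyond (map sumℚ Cs) t (subst (ℕ._≤ t) (sym (trans (ListP.length-map sumℚ Cs) lengths)) i≤t)))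
                 (ℚP.+-identityˡ _))

  -- The alternative for an assignment that uses none of the bins ≥ i for
  -- the items of the earlier blocks nor for the removed item: put every
  -- earlier block into its own bin, which covers every coverable earlier bin.
  resolve-in-blocks : ∀ Cs aQ s l aT → let a = aQ ++ (s , l) ∷ aT in
    CoveredOrHopeless P Cs (sumℚ (sizes a)) → sizes aQ ≡ concat Cs →
    All (λ x → ¬ High i (proj₂ x)) aQ → ¬ High i l → NonNeg (sizes a) →
    Replacement X i d a (concat Cs ++ sizes aT)
  resolve-in-blocks Cs aQ s l aT (lengths , covered-or-hopeless) aQ-items aQ-low l-low a≥0 =
    replacement b b-items empties
      (coverProfit-≤-except X (loads a) (loads b) i d d≥0 others
        (gain-≤-+ (at X i) (loadAt i a) (loadAt i b) (at≥0 i) (ℚP.≤-reflexive at-i)))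
    where
    a = aQ ++ (s , l) ∷ aT
    b = blocksThen Cs aT
    b-items : sizes b ≡ concat Cs ++ sizes aT
    b-items = trans (ListP.map-++ proj₁ (blockLabels Cs) _) (cong₂ _++_ (sizes-blockLabels Cs) (sizes-relabel _ aT))
    empties : loadAt i b ≡ 0ℚ
    empties = trans (blocksThen-from Cs aT i lengths ℕP.≤-refl) (loadAt-redirect-source i nothing aT refl)
    aT≥0 : NonNeg (sizes aT)
    aT≥0 = ++⁻ʳ [ s ] (++⁻ʳ (sizes aQ) (subst NonNeg (ListP.map-++ proj₁ aQ _) a≥0))
    at≥0' : ∀ {t} → t ℕ.< i → 0ℚ ≤ at P t
    at≥0' {t} t<i = subst (0ℚ ≤_) (at-++ˡ P (d ∷ S) t t<i) (at≥0 t)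
    others : ∀ t → t ℕ.< length X → t ≢ i → gain (at X t) (loadAt t a) ≤ gain (at X t) (loadAt t b)
    others t _ t≢i with ℕP.<-cmp t i
    ... | tri≈ _ t≡i _ = ⊥-elim (t≢i t≡i)
    ... | tri> _ _ i<t = ℚP.≤-reflexive (cong (gain (at X t))
          (trans (loadAt-low-above t aQ s l aT i<t aQ-low l-low)
                 (sym (trans (blocksThen-from Cs aT t lengths (ℕP.<⇒≤ i<t))
                             (loadAt-redirect-other i nothing t aT (ℕP.<⇒≢ i<t ∘ sym) refl)))))
    ... | tri< t<i _ _ rewrite at-++ˡ P (d ∷ S) t t<i with covered-or-hopeless t t<i
    ...   | inj₁ covered  = ℚP.≤-trans (gain-≤ (at P t) (loadAt t a) (at≥0' t<i))
                              (ℚP.≤-reflexive (sym (gain-covered (at P t) (loadAt t b)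
                                (ℚP.≤-trans covered (blocksThen-below Cs aT t aT≥0)))))
    ...   | inj₂ hopeless = subst (_≤ gain (at P t) (loadAt t b))
                              (sym (gain-uncovered (at P t) (loadAt t a)
                                     (ℚP.≤-<-trans (loadWhere-≤-total (isBin t) a a≥0) hopeless)))
                              (gain-nonneg (at P t) (loadAt t b) (at≥0' t<i))

  -- The removed item s is taken out; if an earlier item q ≥ s sat in a bin
  -- c ≥ i, q takes the place of s instead, so that only bin c loses an item.
  module Exchange (Cs : List (List ℚ)) (s : ℚ) (T : List ℚ) (S≤d : All (_≤ d) S)
                  (J≥0 : NonNeg (concat Cs ++ s ∷ T)) where

    private
      Q = concat Cs
      J'≥0 : NonNeg (Q ++ T)
      J'≥0 = ++⁺ (++⁻ˡ Q J≥0) (All.tail (++⁻ʳ Q J≥0))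

    via-removed-item : ∀ aQ c aT → i ℕ.≤ c → sizes aQ ≡ Q → sizes aT ≡ T →
                       Replacement X i d (aQ ++ (s , just c) ∷ aT) (Q ++ T)
    via-removed-item aQ c aT i≤c aQ-items aT-items =
      subst (Replacement X i d (aQ ++ (s , just c) ∷ aT)) a°-items
        (resolve-high _ a° s c i≤c S≤d (subst NonNeg (sym a°-items) J'≥0) loses)
      where
      a° = aQ ++ aT
      a°-items : sizes a° ≡ Q ++ T
      a°-items = trans (ListP.map-++ proj₁ aQ aT) (cong₂ _++_ aQ-items aT-items)
      loses : LosesItem (aQ ++ (s , just c) ∷ aT) a° s c
      loses k = ℚP.≤-reflexive (begin
        loadAt k (aQ ++ (s , just c) ∷ aT)      ≡⟨ loadWhere-++ (isBin k) aQ _ ⟩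
        loadAt k aQ + (contribution k s c + loadAt k aT)
          ≡⟨ solve 3 (λ w x z → w :+ (x :+ z) := (w :+ z) :+ x) refl (loadAt k aQ) (contribution k s c) (loadAt k aT) ⟩
        (loadAt k aQ + loadAt k aT) + contribution k s c
          ≡⟨ cong (_+ contribution k s c) (sym (loadWhere-++ (isBin k) aQ aT)) ⟩
        loadAt k a° + contribution k s c         ∎)
        where open ≡-Reasoning

    -- An earlier item q ≥ s sat in a bin c ≥ i: q takes the label of s and s
    -- is dropped; loads only decrease, except by q in bin c.
    via-swapped-item : ∀ A1 q c A2 l aT → i ℕ.≤ c → s ≤ q → sizes (A1 ++ (q , just c) ∷ A2) ≡ Q → sizes aT ≡ T →
                       Replacement X i d ((A1 ++ (q , just c) ∷ A2) ++ (s , l) ∷ aT) (Q ++ T)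
    via-swapped-item A1 q c A2 l aT i≤c s≤q aQ-items aT-items =
      subst (Replacement X i d _) a°-items
        (resolve-high _ a° q c i≤c S≤d (subst NonNeg (sym a°-items) J'≥0) loses)
      where
      a° = (A1 ++ (q , l) ∷ A2) ++ aT
      relabelled : ∀ A1 → sizes (A1 ++ (q , l) ∷ A2) ≡ sizes (A1 ++ (q , just c) ∷ A2)
      relabelled []       = refl
      relabelled (x ∷ A1) = cong (proj₁ x ∷_) (relabelled A1)
      a°-items : sizes a° ≡ Q ++ T
      a°-items = trans (ListP.map-++ proj₁ (A1 ++ (q , l) ∷ A2) aT)
                       (cong₂ _++_ (trans (relabelled A1) aQ-items) aT-items)
      loses : LosesItem ((A1 ++ (q , just c) ∷ A2) ++ (s , l) ∷ aT) a° q c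
      loses k = begin
        loadAt k ((A1 ++ (q , just c) ∷ A2) ++ (s , l) ∷ aT)
          ≡⟨ trans (loadWhere-++ (isBin k) (A1 ++ _) _) (cong (_+ _) (loadWhere-++ (isBin k) A1 _)) ⟩
        (w + (contribution k q c + y)) + ((if isBin k l then s else 0ℚ) + z)
          ≤⟨ ℚP.+-monoʳ-≤ (w + (contribution k q c + y)) (ℚP.+-monoˡ-≤ z (smaller (isBin k l))) ⟩
        (w + (contribution k q c + y)) + ((if isBin k l then q else 0ℚ) + z)
          ≡⟨ solve 5 (λ w x y v z → (w :+ (x :+ y)) :+ (v :+ z) := ((w :+ (v :+ y)) :+ z) :+ x) refl
                     w (contribution k q c) y (if isBin k l then q else 0ℚ) z ⟩
        ((w + ((if isBin k l then q else 0ℚ) + y)) + z) + contribution k q c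
          ≡⟨ cong (_+ contribution k q c) (sym (trans (loadWhere-++ (isBin k) (A1 ++ _) aT) (cong (_+ z) (loadWhere-++ (isBin k) A1 _)))) ⟩
        loadAt k a° + contribution k q c ∎
        where
        open ℚP.≤-Reasoning
        w = loadAt k A1
        y = loadAt k A2
        z = loadAt k aT
        smaller : ∀ b → (if b then s else 0ℚ) ≤ (if b then q else 0ℚ)
        smaller true  = s≤q
        smaller false = ℚP.≤-refl

    exchange : ∀ a → sizes a ≡ Q ++ s ∷ T → CoveredOrHopeless P Cs (sumℚ (Q ++ s ∷ T)) → All (s ≤_) Q →
               Replacement X i d a (Q ++ T)
    exchange a a-items coh s≤Q with split-assignment Q s T a a-items
    ... | aQ , l , aT , refl , aQ-items , aT-items with any? (high? i ∘ proj₂) aQ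
    ...   | yes some-high with find some-high
    ...     | (q , nothing) , _  , ()
    ...     | (q , just c)  , q∈ , i≤c with ∈-∃++ q∈
    ...       | A1 , A2 , refl =
      via-swapped-item A1 q c A2 l aT i≤c (All.lookup (subst (All (s ≤_)) (sym aQ-items) s≤Q) (∈-map⁺ proj₁ q∈))
                       aQ-items aT-items
    exchange a a-items coh s≤Q | aQ , l , aT , refl , aQ-items , aT-items | no none-high with l | high? i l
    ...   | just c | yes i≤c = via-removed-item aQ c aT i≤c aQ-items aT-items
    ...   | l'     | no  l-low =
      subst (Replacement X i d _) (cong (Q ++_) aT-items)
        (resolve-in-blocks Cs aQ s l' aT (subst (CoveredOrHopeless P Cs ∘ sumℚ) (sym a-items) coh)
                           aQ-items (¬Any⇒All¬ aQ none-high) l-low (subst NonNeg (sym a-items) J≥0))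

OPT-remove-bin : ∀ P Cs d S s T →
  CoveredOrHopeless P Cs (sumℚ (concat Cs ++ s ∷ T)) → All (s ≤_) (concat Cs) → All (_≤ d) S → 0ℚ < d →
  NonNeg (P ++ d ∷ S) → NonNeg (concat Cs ++ s ∷ T) →
  OPT (P ++ d ∷ S) (concat Cs ++ s ∷ T) ≤ OPT (P ++ S) (concat Cs ++ T) + d
OPT-remove-bin P Cs d S s T coh s≤Q S≤d d>0 X≥0 J≥0 =
  OPT-≤ (P ++ d ∷ S) _ _ (ℚP.≤-trans (OPT-nonneg (P ++ S) (concat Cs ++ T)) (≤-+-nonnegʳ _ (ℚP.<⇒≤ d>0))) bound
  where
  open Exchange P d S d>0 X≥0 Cs s T S≤d J≥0
  bound : ∀ a → sizes a ≡ concat Cs ++ s ∷ T → coverProfit (P ++ d ∷ S) (loads a) ≤ OPT (P ++ S) (concat Cs ++ T) + d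
  bound a a-items with exchange a a-items coh s≤Q
  ... | replacement b b-items empties loses-≤ = ℚP.≤-trans loses-≤ (ℚP.+-monoˡ-≤ d (begin
    coverProfit (P ++ d ∷ S) (loads b)                              ≡⟨ coverProfit-emptied P d S b d>0 empties ⟩
    coverProfit (P ++ S) (loads (relabel (deleteBin (length P)) b)) ≤⟨ OPT-≥ (P ++ S) _ _ (trans (sizes-relabel _ b) b-items) ⟩
    OPT (P ++ S) (concat Cs ++ T)                                   ∎))
    where open ℚP.≤-Reasoning

Decreasing : List ℚ → Set
Decreasing = AllPairs _≥_

decreasing-++ʳ : ∀ xs {ys} → Decreasing (xs ++ ys) → Decreasing ys
decreasing-++ʳ []       dec = dec
decreasing-++ʳ (x ∷ xs) dec = decreasing-++ʳ xs (AllPairs.tail dec)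

decreasing-++-dominates : ∀ xs {ys} → Decreasing (xs ++ ys) → All (λ x → All (_≤ x) ys) xs
decreasing-++-dominates []       dec       = []
decreasing-++-dominates (x ∷ xs) (x≥ ∷ dec) = ++⁻ʳ xs x≥ ∷ decreasing-++-dominates xs dec

CoveredOrHopeless-mono : ∀ P Cs {total total'} → total' ≤ total →
  CoveredOrHopeless P Cs total → CoveredOrHopeless P Cs total'
CoveredOrHopeless-mono P Cs {total} {total'} total'≤ (lengths , coh) = lengths , λ t t< → weaken (coh t t<)
  where
  weaken : ∀ {x y} → x ≤ y ⊎ total < x → x ≤ y ⊎ total' < x
  weaken (inj₁ covered)  = inj₁ covered
  weaken (inj₂ hopeless) = inj₂ (ℚP.≤-<-trans total'≤ hopeless)

CoveredOrHopeless-extend : ∀ P Cs total d B → CoveredOrHopeless P Cs total → d ≤ sumℚ B ⊎ total < d →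
  CoveredOrHopeless (P ++ [ d ]) (Cs ++ [ B ]) total
CoveredOrHopeless-extend P Cs total d B (lengths , coh) new = lengths' , coh'
  where
  lengths' : length (Cs ++ [ B ]) ≡ length (P ++ [ d ])
  lengths' = trans (ListP.length-++ Cs) (trans (cong (ℕ._+ 1) lengths) (sym (ListP.length-++ P)))
  coh' : ∀ t → t ℕ.< length (P ++ [ d ]) → at (P ++ [ d ]) t ≤ blockLoad (Cs ++ [ B ]) t ⊎ total < at (P ++ [ d ]) t
  coh' t t< with ℕP.<-cmp t (length P)
  ... | tri< t<P _ _ rewrite at-++ˡ P [ d ] t t<P | blockLoad-snoc-before Cs B t (subst (t ℕ.<_) (sym lengths) t<P) =
    coh t t<P
  ... | tri≈ _ refl _ rewrite at-middle P d [] | sym lengths | blockLoad-snoc-last Cs B = new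
  ... | tri> _ _ P<t = ⊥-elim (ℕP.<⇒≱ t< (subst (ℕ._≤ t) (sym (trans (ListP.length-++ P) (ℕP.+-comm (length P) 1))) P<t))

concat-snoc : ∀ (Cs : List (List ℚ)) B → concat (Cs ++ [ B ]) ≡ concat Cs ++ B
concat-snoc []       B = ListP.++-identityʳ B
concat-snoc (C ∷ Cs) B = trans (cong (C ++_) (concat-snoc Cs B)) (sym (ListP.++-assoc C (concat Cs) B))

removed-block-single : ∀ {d R B R'} → StepKind d R B R' → 0ℚ < d → Decreasing R → NonNeg R →
                       d + d ≤ sumℚ B → ∃[ s ] (R ≡ s ∷ R' × B ≡ [ s ])
removed-block-single (skipped _) d>0 _ _ 2d≤0 = ⊥-elim (<⇒≱ (ℚP.+-mono-< d>0 d>0) 2d≤0)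
removed-block-single {d} {[]} (filled d≤0 _) d>0 _ _ _ = ⊥-elim (<⇒≱ d>0 d≤0)
removed-block-single {d} {s ∷ rest} (filled _ takeCover≡) d>0 (rest≤s ∷ _) (s≥0 ∷ _) 2d≤B
  with trans (sym takeCover≡) (takeCover-single d s rest d>0 s≥0 rest≤s (subst (λ r → d + d ≤ sumℚ (proj₁ r)) (sym takeCover≡) 2d≤B))
... | refl = s , refl , refl

new-bin-status : ∀ {d B R'} Q → StepKind d (B ++ R') B R' → (null B ≡ true → Q ≡ []) →
                 d ≤ sumℚ B ⊎ sumℚ (Q ++ B ++ R') < d
new-bin-status {d} {B} {R'} Q (skipped R<d) earlier-empty =
  inj₂ (subst (λ Q → sumℚ (Q ++ R') < d) (sym (earlier-empty refl)) R<d)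
new-bin-status {d} {B} {R'} Q (filled d≤R takeCover≡) _ =
  inj₁ (subst (λ r → d ≤ sumℚ (proj₁ r)) takeCover≡ (takeCover-covers d (B ++ R') d≤R))

ratio-zero : ∀ a b → b ≡ 0ℚ → ratio a b ≡ 1ℚ
ratio-zero a b b≡0 with b ℚP.≟ 0ℚ
... | yes _   = refl
... | no  b≢0 = ⊥-elim (b≢0 b≡0)

ratio-nonzero : ∀ a b (b≢0 : b ≢ 0ℚ) → ratio a b ≡ (a ÷ b) {{≢-nonZero b≢0}}
ratio-nonzero a b b≢0 with b ℚP.≟ 0ℚ
... | yes b≡0 = ⊥-elim (b≢0 b≡0)
... | no  _   = refl

pos⇒≢0 : ∀ {x} → 0ℚ < x → x ≢ 0ℚ
pos⇒≢0 x>0 = ℚP.<⇒≢ x>0 ∘ sym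

nonneg-≢-pos : ∀ {x} → 0ℚ ≤ x → x ≢ 0ℚ → 0ℚ < x
nonneg-≢-pos {x} x≥0 x≢0 with ℚP.<-cmp 0ℚ x
... | tri< 0<x _ _ = 0<x
... | tri≈ _ 0≡x _ = ⊥-elim (x≢0 (sym 0≡x))
... | tri> _ _ x<0 = ⊥-elim (<⇒≱ x<0 x≥0)

÷-cross : ∀ a b c e (b>0 : 0ℚ < b) (e>0 : 0ℚ < e) → a * e ≤ c * b →
  (a ÷ b) {{≢-nonZero (pos⇒≢0 b>0)}} ≤ (c ÷ e) {{≢-nonZero (pos⇒≢0 e>0)}}
÷-cross a b c e b>0 e>0 ae≤cb =
  ℚP.*-cancelʳ-≤-pos (b * e) {{ℚP.pos*pos⇒pos b {{positive b>0}} e {{positive e>0}}}}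
    (subst₂ _≤_ (sym (cancel a b e b>0)) (sym (trans (cong ((c ÷ e) {{≢-nonZero (pos⇒≢0 e>0)}} *_) (ℚP.*-comm b e)) (cancel c e b e>0))) ae≤cb)
  where
  cancel : ∀ a b e (b>0 : 0ℚ < b) → (a * (1/ b) {{≢-nonZero (pos⇒≢0 b>0)}}) * (b * e) ≡ a * e
  cancel a b e b>0 =
    trans (solve 4 (λ a b⁻¹ b e → (a :* b⁻¹) :* (b :* e) := (a :* e) :* (b⁻¹ :* b)) refl a b⁻¹ b e)
          (trans (cong ((a * e) *_) (ℚP.*-inverseˡ b {{≢-nonZero (pos⇒≢0 b>0)}})) (ℚP.*-identityʳ (a * e)))
    where b⁻¹ = (1/ b) {{≢-nonZero (pos⇒≢0 b>0)}}

ratio-remove : ∀ O N O' N' D → 0ℚ ≤ D → 0ℚ ≤ N' → N' ≤ O' → N ≡ N' + D → O ≤ O' + D →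
               (N' ≡ 0ℚ → O' ≤ 0ℚ) → ratio O N ≤ ratio O' N'
ratio-remove O N O' N' D D≥0 N'≥0 N'≤O' N≡ O≤ N'-zero with toSum (N' ℚP.≟ 0ℚ) | toSum (N ℚP.≟ 0ℚ)
... | inj₁ N'≡0 | inj₁ N≡0 = ℚP.≤-reflexive (trans (ratio-zero O N N≡0) (sym (ratio-zero O' N' N'≡0)))
... | inj₁ N'≡0 | inj₂ N≢0 =
  subst₂ _≤_ (sym (ratio-nonzero O N N≢0)) (sym (ratio-zero O' N' N'≡0))
    (÷-cross O N 1ℚ 1ℚ N>0 (ℚP.positive⁻¹ 1ℚ) (subst₂ _≤_ (sym (ℚP.*-identityʳ O)) (sym (ℚP.*-identityˡ N)) O≤N))
  where
  N>0 = nonneg-≢-pos (subst (0ℚ ≤_) (sym N≡) (ℚP.+-mono-≤ N'≥0 D≥0)) N≢0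
  O≤N : O ≤ N
  O≤N = ℚP.≤-trans O≤ (subst (O' + D ≤_) (sym N≡) (ℚP.+-monoˡ-≤ D (ℚP.≤-trans (N'-zero N'≡0) (ℚP.≤-reflexive (sym N'≡0)))))
... | inj₂ N'≢0 | inj₁ N≡0 =
  ⊥-elim (N'≢0 (ℚP.≤-antisym (subst (N' ≤_) (trans (sym N≡) N≡0) (≤-+-nonnegʳ N' D≥0)) N'≥0))
... | inj₂ N'≢0 | inj₂ N≢0 =
  subst₂ _≤_ (sym (ratio-nonzero O N N≢0)) (sym (ratio-nonzero O' N' N'≢0)) (÷-cross O N O' N' N>0 N'>0 cross)
  where
  N>0 = nonneg-≢-pos (subst (0ℚ ≤_) (sym N≡) (ℚP.+-mono-≤ N'≥0 D≥0)) N≢0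
  N'>0 = nonneg-≢-pos N'≥0 N'≢0
  cross : O * N' ≤ O' * N
  cross = begin
    O * N'              ≤⟨ ℚP.*-monoʳ-≤-nonNeg N' {{nonNegative N'≥0}} O≤ ⟩
    (O' + D) * N'       ≡⟨ ℚP.*-distribʳ-+ N' O' D ⟩
    O' * N' + D * N'    ≤⟨ ℚP.+-monoʳ-≤ (O' * N') (ℚP.*-monoˡ-≤-nonNeg D {{nonNegative D≥0}} N'≤O') ⟩
    O' * N' + D * O'    ≡⟨ solve 3 (λ O' N' D → O' :* N' :+ D :* O' := O' :* (N' :+ D)) refl O' N' D ⟩
    O' * (N' + D)       ≡⟨ cong (O' *_) (sym N≡) ⟩
    O' * N              ∎
    where open ℚP.≤-Reasoning

module Reduction (i* : ℕ) where

  removable : ℕ → ℚ → List ℚ → Bool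
  removable i d b = does (i ℕ.≤? i*) ∧ does (((1ℚ + 1ℚ) * d) ℚP.≤? sumℚ b)

  removedDemand : ℕ → List ℚ → List (List ℚ) → ℚ
  removedDemand i (d ∷ ds) (b ∷ bs) =
    if removable i d b then d + removedDemand (suc i) ds bs else removedDemand (suc i) ds bs
  removedDemand _ _ _ = 0ℚ

  keptBlocks : ℕ → List ℚ → List (List ℚ) → List (List ℚ)
  keptBlocks i (d ∷ ds) (b ∷ bs) =
    if removable i d b then keptBlocks (suc i) ds bs else b ∷ keptBlocks (suc i) ds bs
  keptBlocks _ _ _ = []

  data ReduceStep (i : ℕ) (d : ℚ) (ds : List ℚ) (b : List ℚ) (bs : List (List ℚ)) : Set where
    removed : removable i d b ≡ true →
              reduceGo i* i (d ∷ ds) (b ∷ bs) ≡ reduceGo i* (suc i) ds bs →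
              removedDemand i (d ∷ ds) (b ∷ bs) ≡ d + removedDemand (suc i) ds bs →
              keptBlocks i (d ∷ ds) (b ∷ bs) ≡ keptBlocks (suc i) ds bs → ReduceStep i d ds b bs
    kept    : removable i d b ≡ false →
              reduceGo i* i (d ∷ ds) (b ∷ bs) ≡ (d ∷ proj₁ (reduceGo i* (suc i) ds bs) , b ++ proj₂ (reduceGo i* (suc i) ds bs)) →
              removedDemand i (d ∷ ds) (b ∷ bs) ≡ removedDemand (suc i) ds bs →
              keptBlocks i (d ∷ ds) (b ∷ bs) ≡ b ∷ keptBlocks (suc i) ds bs → ReduceStep i d ds b bs

  reduceStep : ∀ i d ds b bs → ReduceStep i d ds b bs
  reduceStep i d ds b bs with removable i d b in eq
  ... | true  = removed eq (if-true eq) (if-true eq) (if-true eq)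
  ... | false = kept eq (if-false eq) (if-false eq) (if-false eq)

  removable-sound : ∀ i d b → removable i d b ≡ true → (i ℕ.≤ i*) × (d + d ≤ sumℚ b)
  removable-sound i d b eq =
    does-true (i ℕ.≤? i*) (∧-conicalˡ _ _ eq) ,
    subst (_≤ sumℚ b) two-d (does-true (((1ℚ + 1ℚ) * d) ℚP.≤? sumℚ b) (∧-conicalʳ _ _ eq))
    where
    two-d : (1ℚ + 1ℚ) * d ≡ d + d
    two-d = trans (ℚP.*-distribʳ-+ d 1ℚ 1ℚ) (cong₂ _+_ (ℚP.*-identityˡ d) (ℚP.*-identityˡ d))

  reduce-beyond : ∀ i ds bs → i* ℕ.< i → length ds ≡ length bs →
    (reduceGo i* i ds bs ≡ (ds , concat bs)) × (removedDemand i ds bs ≡ 0ℚ) × (keptBlocks i ds bs ≡ bs)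
  reduce-beyond i []       []       _    _   = refl , refl , refl
  reduce-beyond i (d ∷ ds) (b ∷ bs) i*<i len with reduceStep i d ds b bs
  ... | removed rem _ _ _ = ⊥-elim (ℕP.<⇒≱ i*<i (proj₁ (removable-sound i d b rem)))
  ... | kept _ go≡ D≡ K≡ with reduce-beyond (suc i) ds bs (ℕP.m<n⇒m<1+n i*<i) (ℕP.suc-injective len)
  ...   | go≡' , D≡' , K≡' =
    trans go≡ (cong (λ r → d ∷ proj₁ r , b ++ proj₂ r) go≡') , trans D≡ D≡' , trans K≡ (cong (b ∷_) K≡')

  removedDemand-nonneg : ∀ i ds bs → Positive ds → 0ℚ ≤ removedDemand i ds bs
  removedDemand-nonneg i []       bs       _            = ℚP.≤-refl
  removedDemand-nonneg i (d ∷ ds) []       _            = ℚP.≤-refl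
  removedDemand-nonneg i (d ∷ ds) (b ∷ bs) (d>0 ∷ ds>0) with reduceStep i d ds b bs
  ... | removed _ _ D≡ _ = subst (0ℚ ≤_) (sym D≡) (ℚP.+-mono-≤ (ℚP.<⇒≤ d>0) (removedDemand-nonneg (suc i) ds bs ds>0))
  ... | kept    _ _ D≡ _ = subst (0ℚ ≤_) (sym D≡) (removedDemand-nonneg (suc i) ds bs ds>0)

  keptBins-positive : ∀ i ds bs → Positive ds → Positive (proj₁ (reduceGo i* i ds bs))
  keptBins-positive i []       bs       _            = []
  keptBins-positive i (d ∷ ds) []       _            = []
  keptBins-positive i (d ∷ ds) (b ∷ bs) (d>0 ∷ ds>0) with reduceStep i d ds b bs
  ... | removed _ go≡ _ _ = subst (Positive ∘ proj₁) (sym go≡) (keptBins-positive (suc i) ds bs ds>0)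
  ... | kept    _ go≡ _ _ = subst (Positive ∘ proj₁) (sym go≡) (d>0 ∷ keptBins-positive (suc i) ds bs ds>0)

  blocksProfit-split : ∀ i ds bs → length bs ≡ length ds → Positive ds →
    blocksProfit ds bs ≡ blocksProfit (proj₁ (reduceGo i* i ds bs)) (keptBlocks i ds bs) + removedDemand i ds bs
  blocksProfit-split i []       []       _   _            = sym (ℚP.+-identityʳ 0ℚ)
  blocksProfit-split i (d ∷ ds) (b ∷ bs) len (d>0 ∷ ds>0) with reduceStep i d ds b bs
  ... | removed rem go≡ D≡ K≡ rewrite go≡ | D≡ | K≡ = begin
    gain d (sumℚ b) + blocksProfit ds bs  ≡⟨ cong₂ _+_ (gain-covered d (sumℚ b) d≤b) IH ⟩
    d + (P' + D')                          ≡⟨ sym (ℚP.+-assoc d P' D') ⟩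
    (d + P') + D'                          ≡⟨ cong (_+ D') (ℚP.+-comm d P') ⟩
    (P' + d) + D'                          ≡⟨ ℚP.+-assoc P' d D' ⟩
    P' + (d + D')                          ∎
    where
    open ≡-Reasoning
    P' = blocksProfit (proj₁ (reduceGo i* (suc i) ds bs)) (keptBlocks (suc i) ds bs)
    D' = removedDemand (suc i) ds bs
    IH = blocksProfit-split (suc i) ds bs (ℕP.suc-injective len) ds>0
    d≤b : d ≤ sumℚ b
    d≤b = ℚP.≤-trans (≤-+-nonnegʳ d (ℚP.<⇒≤ d>0)) (proj₂ (removable-sound i d b rem))
  ... | kept _ go≡ D≡ K≡ rewrite go≡ | D≡ | K≡ =
    trans (cong (gain d (sumℚ b) +_) (blocksProfit-split (suc i) ds bs (ℕP.suc-injective len) ds>0))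
          (sym (ℚP.+-assoc (gain d (sumℚ b)) _ _))

  keptBins : ℕ → List ℚ → List ℚ → List ℚ
  keptBins i ds R = proj₁ (reduceGo i* i ds (blocks ds R))

  keptItems : ℕ → List ℚ → List ℚ → List ℚ
  keptItems i ds R = proj₂ (reduceGo i* i ds (blocks ds R)) ++ leftover ds R

  keptItems-nonneg : ∀ i ds R → Positive ds → NonNeg R → NonNeg (keptItems i ds R)
  keptItems-nonneg i []       R _            R≥0 = R≥0
  keptItems-nonneg i (d ∷ ds) R (d>0 ∷ ds>0) R≥0 with nfdStep d ds R d>0
  ... | step B R' unfold R≡ _ rewrite unfold with reduceStep i d ds B (blocks ds R')
  ...   | removed _ go≡ _ _ rewrite go≡ = keptItems-nonneg (suc i) ds R' ds>0 R'≥0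
    where R'≥0 = ++⁻ʳ B (subst NonNeg R≡ R≥0)
  ...   | kept    _ go≡ _ _ rewrite go≡ =
    subst NonNeg (sym (ListP.++-assoc B _ _)) (++⁺ (++⁻ˡ B (subst NonNeg R≡ R≥0)) (keptItems-nonneg (suc i) ds R' ds>0 R'≥0))
    where R'≥0 = ++⁻ʳ B (subst NonNeg R≡ R≥0)

  keptItems-≤ : ∀ i ds R → Positive ds → NonNeg R → sumℚ (keptItems i ds R) ≤ sumℚ R
  keptItems-≤ i []       R _            _   = ℚP.≤-refl
  keptItems-≤ i (d ∷ ds) R (d>0 ∷ ds>0) R≥0 with nfdStep d ds R d>0
  ... | step B R' unfold R≡ _ rewrite unfold | R≡ with reduceStep i d ds B (blocks ds R')
  ...   | removed _ go≡ _ _ rewrite go≡ = begin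
    sumℚ (keptItems (suc i) ds R')  ≤⟨ keptItems-≤ (suc i) ds R' ds>0 R'≥0 ⟩
    sumℚ R'                         ≤⟨ ≤-+-nonnegˡ (sumℚ R') (sumℚ-nonneg B (++⁻ˡ B R≥0)) ⟩
    sumℚ B + sumℚ R'                ≡⟨ sym (sumℚ-++ B R') ⟩
    sumℚ (B ++ R')                  ∎
    where
    open ℚP.≤-Reasoning
    R'≥0 = ++⁻ʳ B R≥0
  ...   | kept    _ go≡ _ _ rewrite go≡ = begin
    sumℚ ((B ++ K) ++ leftover ds R')    ≡⟨ cong sumℚ (ListP.++-assoc B K _) ⟩
    sumℚ (B ++ keptItems (suc i) ds R')  ≡⟨ sumℚ-++ B _ ⟩
    sumℚ B + sumℚ (keptItems (suc i) ds R') ≤⟨ ℚP.+-monoʳ-≤ (sumℚ B) (keptItems-≤ (suc i) ds R' ds>0 (++⁻ʳ B R≥0)) ⟩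
    sumℚ B + sumℚ R'                     ≡⟨ sym (sumℚ-++ B R') ⟩
    sumℚ (B ++ R')                       ∎
    where
    open ℚP.≤-Reasoning
    K = proj₂ (reduceGo i* (suc i) ds (blocks ds R'))

  nfd-reduced : ∀ i ds R → Positive ds → NonNeg R →
    nfd (keptBins i ds R) (keptItems i ds R) ≡ (keptBlocks i ds (blocks ds R) , leftover ds R)
  nfd-reduced i []       R _            _   = refl
  nfd-reduced i (d ∷ ds) R (d>0 ∷ ds>0) R≥0 with nfdStep d ds R d>0
  ... | step B R' unfold R≡ kind rewrite unfold with reduceStep i d ds B (blocks ds R')
  ...   | removed _ go≡ _ K≡ rewrite go≡ | K≡ = nfd-reduced (suc i) ds R' ds>0 R'≥0
    where R'≥0 = ++⁻ʳ B (subst NonNeg R≡ R≥0)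
  ...   | kept    _ go≡ _ K≡ rewrite go≡ | K≡ =
    trans (cong (nfd (d ∷ keptBins (suc i) ds R')) (ListP.++-assoc B _ (leftover ds R')))
          (trans (first-bin kind)
                 (cong (λ r → B ∷ proj₁ r , proj₂ r) (nfd-reduced (suc i) ds R' ds>0 R'≥0)))
    where
    R'≥0 = ++⁻ʳ B (subst NonNeg R≡ R≥0)
    Z = keptItems (suc i) ds R'
    K = keptBins (suc i) ds R'
    first-bin : StepKind d R B R' → nfd (d ∷ keptBins (suc i) ds R') (B ++ Z) ≡
                                    (B ∷ blocks (keptBins (suc i) ds R') Z , leftover (keptBins (suc i) ds R') Z)
    first-bin (skipped R<d) =
      nfd-skip d _ Z (ℚP.≤-<-trans (keptItems-≤ (suc i) ds R ds>0 R≥0) R<d)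
    first-bin (filled d≤R takeCover≡) =
      subst (λ B → nfd (d ∷ K) (B ++ Z) ≡ (B ∷ blocks K Z , leftover K Z)) (cong proj₁ takeCover≡)
            (nfd-fill-prefix d _ R Z d>0 d≤R (keptItems-nonneg (suc i) ds R' ds>0 R'≥0))

  NFD-reduced : ∀ ds R → Positive ds → NonNeg R →
    NFD ds R ≡ NFD (keptBins 1 ds R) (keptItems 1 ds R) + removedDemand 1 ds (blocks ds R)
  NFD-reduced ds R ds>0 R≥0 =
    trans (blocksProfit-split 1 ds (blocks ds R) (nfd-length ds R ds>0) ds>0)
          (cong (λ Bs → blocksProfit (keptBins 1 ds R) Bs + removedDemand 1 ds (blocks ds R))
                (sym (cong proj₁ (nfd-reduced 1 ds R ds>0 R≥0))))

  -- NoGap p prevEmpty Bs: among the blocks of the bins p, p+1, … ≤ i*, a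
  -- nonempty block is never followed by an empty one (prevEmpty tells whether
  -- the block before Bs is empty).
  NoGap : ℕ → Bool → List (List ℚ) → Set
  NoGap p prevEmpty []       = ⊤
  NoGap p prevEmpty (B ∷ Bs) = (prevEmpty ≡ false → p ℕ.≤ i* → null B ≡ false) × NoGap (suc p) (null B) Bs

  -- Beyond i* nothing is removed, so OPT is unchanged.
  OPT-reduce-beyond : ∀ p P Q ds R → i* ℕ.< p → Positive ds →
    OPT (P ++ ds) (Q ++ R) ≤ OPT (P ++ keptBins p ds R) (Q ++ keptItems p ds R) + removedDemand p ds (blocks ds R)
  OPT-reduce-beyond p P Q ds R i*<p ds>0
    with reduce-beyond p ds (blocks ds R) i*<p (sym (nfd-length ds R ds>0))
  ... | go≡ , D≡ , _ rewrite go≡ | D≡ =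
    ℚP.≤-reflexive (trans (cong (λ J → OPT (P ++ ds) (Q ++ J)) (nfd-items ds R ds>0)) (sym (ℚP.+-identityʳ _)))

  -- The invariant while walking through the bins ds (from 1-based index p
  -- on) with remaining items R, the bins P with blocks Cs being already kept.
  record Invariant (p : ℕ) (prevEmpty : Bool) (P : List ℚ) (Cs : List (List ℚ)) (ds R : List ℚ) : Set where
    field
      no-gap       : NoGap p prevEmpty (blocks ds R)
      starts-empty : prevEmpty ≡ true → concat Cs ≡ []
      earlier-bins : CoveredOrHopeless P Cs (sumℚ (concat Cs ++ R))
      dominated    : All (λ q → All (_≤ q) R) (concat Cs)
      R↓           : Decreasing R
      R≥0          : NonNeg R
      kept≥0       : NonNeg (concat Cs)
      ds↓          : Decreasing ds
      ds>0         : Positive ds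
      P≥0          : NonNeg P

  invariant-removed : ∀ {p prevEmpty P Cs d ds s R'} → Invariant p prevEmpty P Cs (d ∷ ds) (s ∷ R') →
    blocks (d ∷ ds) (s ∷ R') ≡ [ s ] ∷ blocks ds R' → Invariant (suc p) false P Cs ds R'
  invariant-removed {P = P} {Cs} {d} {ds} {s} {R'} inv unfold = record
    { no-gap       = proj₂ (subst (NoGap _ _) unfold no-gap)
    ; starts-empty = λ ()
    ; earlier-bins = CoveredOrHopeless-mono P Cs smaller earlier-bins
    ; dominated    = All.map All.tail dominated
    ; R↓           = AllPairs.tail R↓
    ; R≥0          = All.tail R≥0
    ; kept≥0       = kept≥0
    ; ds↓          = AllPairs.tail ds↓
    ; ds>0         = All.tail ds>0
    ; P≥0          = P≥0
    }
    where
    open Invariant inv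
    Q = concat Cs
    smaller : sumℚ (Q ++ R') ≤ sumℚ (Q ++ s ∷ R')
    smaller = subst₂ _≤_ (sym (sumℚ-++ Q R')) (sym (sumℚ-++ Q (s ∷ R')))
                (ℚP.+-monoʳ-≤ (sumℚ Q) (≤-+-nonnegˡ (sumℚ R') (All.head R≥0)))

  invariant-kept : ∀ {p prevEmpty P Cs d ds B R'} → Invariant p prevEmpty P Cs (d ∷ ds) (B ++ R') →
    blocks (d ∷ ds) (B ++ R') ≡ B ∷ blocks ds R' → StepKind d (B ++ R') B R' → p ℕ.≤ i* →
    Invariant (suc p) (null B) (P ++ [ d ]) (Cs ++ [ B ]) ds R'
  invariant-kept {p} {prevEmpty} {P} {Cs} {d} {ds} {B} {R'} inv unfold kind p≤i* = record
    { no-gap       = proj₂ no-gap'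
    ; starts-empty = λ B-empty → trans (concat-snoc Cs B) (trans (cong (_++ B) (earlier-empty B-empty)) (null-[] B B-empty))
    ; earlier-bins = subst (CoveredOrHopeless (P ++ [ d ]) (Cs ++ [ B ]) ∘ sumℚ) (sym same-items)
                           (CoveredOrHopeless-extend P Cs _ d B earlier-bins (new-bin-status Q kind earlier-empty))
    ; dominated    = subst (All (λ q → All (_≤ q) R')) (sym (concat-snoc Cs B))
                           (++⁺ (All.map (++⁻ʳ B) dominated) (decreasing-++-dominates B R↓))
    ; R↓           = decreasing-++ʳ B R↓
    ; R≥0          = ++⁻ʳ B R≥0
    ; kept≥0       = subst NonNeg (sym (concat-snoc Cs B)) (++⁺ kept≥0 (++⁻ˡ B R≥0))
    ; ds↓          = AllPairs.tail ds↓
    ; ds>0         = All.tail ds>0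
    ; P≥0          = ++⁺ P≥0 (ℚP.<⇒≤ (All.head ds>0) ∷ [])
    }
    where
    open Invariant inv
    Q = concat Cs
    no-gap' = subst (NoGap p prevEmpty) unfold no-gap
    earlier-empty : null B ≡ true → Q ≡ []
    earlier-empty B-empty = by-previous prevEmpty starts-empty (proj₁ no-gap')
      where
      by-previous : ∀ b → (b ≡ true → Q ≡ []) → (b ≡ false → p ℕ.≤ i* → null B ≡ false) → Q ≡ []
      by-previous true  empty _   = empty refl
      by-previous false _     gap with () ← trans (sym B-empty) (gap refl p≤i*)
    null-[] : ∀ B → null B ≡ true → B ≡ []
    null-[] [] _ = refl
    same-items : concat (Cs ++ [ B ]) ++ R' ≡ Q ++ B ++ R'
    same-items = trans (cong (_++ R') (concat-snoc Cs B)) (ListP.++-assoc Q B R')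

  OPT-reduce-from : ∀ p prevEmpty P Cs ds R → Invariant p prevEmpty P Cs ds R →
    OPT (P ++ ds) (concat Cs ++ R) ≤
      OPT (P ++ keptBins p ds R) (concat Cs ++ keptItems p ds R) + removedDemand p ds (blocks ds R)
  OPT-reduce-from p prevEmpty P Cs ds R inv with i* ℕ.<? p
  OPT-reduce-from p prevEmpty P Cs ds R inv | yes i*<p =
    OPT-reduce-beyond p P (concat Cs) ds R i*<p (Invariant.ds>0 inv)
  OPT-reduce-from p prevEmpty P Cs [] R inv | no _ = ℚP.≤-reflexive (sym (ℚP.+-identityʳ _))
  OPT-reduce-from p prevEmpty P Cs (d ∷ ds) R inv | no p≰i* with nfdStep d ds R (All.head (Invariant.ds>0 inv))
  ... | step B R' unfold refl kind rewrite unfold with reduceStep p d ds B (blocks ds R')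
  ...   | removed rem go≡ D≡ _ rewrite go≡ | D≡
    with removed-block-single kind (All.head (Invariant.ds>0 inv)) (Invariant.R↓ inv) (Invariant.R≥0 inv)
                              (proj₂ (removable-sound p d B rem))
  ...     | s , refl , refl = begin
    OPT (P ++ d ∷ ds) (Q ++ s ∷ R')
      ≤⟨ OPT-remove-bin P Cs d ds s R' earlier-bins (All.map All.head dominated) (AllPairs.head ds↓) (All.head ds>0)
                        (++⁺ P≥0 (All.map ℚP.<⇒≤ ds>0)) (++⁺ kept≥0 R≥0) ⟩
    OPT (P ++ ds) (Q ++ R') + d
      ≤⟨ ℚP.+-monoˡ-≤ d (OPT-reduce-from (suc p) false P Cs ds R' (invariant-removed inv (cong proj₁ unfold))) ⟩
    (O' + D') + d
      ≡⟨ trans (ℚP.+-assoc O' D' d) (cong (O' +_) (ℚP.+-comm D' d)) ⟩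
    O' + (d + D') ∎
    where
    open ℚP.≤-Reasoning
    open Invariant inv
    Q = concat Cs
    D' = removedDemand (suc p) ds (blocks ds R')
    O' = OPT (P ++ keptBins (suc p) ds R') (Q ++ keptItems (suc p) ds R')
  OPT-reduce-from p prevEmpty P Cs (d ∷ ds) _ inv | no p≰i* | step B R' unfold refl kind | kept _ go≡ D≡ _
    rewrite go≡ | D≡ = begin
    OPT (P ++ d ∷ ds) (Q ++ B ++ R')
      ≡⟨ cong₂ OPT (sym (ListP.++-assoc P [ d ] ds)) (trans (sym (ListP.++-assoc Q B R')) (cong (_++ R') (sym (concat-snoc Cs B)))) ⟩
    OPT ((P ++ [ d ]) ++ ds) (concat (Cs ++ [ B ]) ++ R')
      ≤⟨ OPT-reduce-from (suc p) (null B) (P ++ [ d ]) (Cs ++ [ B ]) ds R'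
                         (invariant-kept inv (cong proj₁ unfold) kind (ℕP.≮⇒≥ p≰i*)) ⟩
    OPT ((P ++ [ d ]) ++ keptBins (suc p) ds R') (concat (Cs ++ [ B ]) ++ keptItems (suc p) ds R') + D'
      ≡⟨ cong (_+ D') (cong₂ OPT (ListP.++-assoc P [ d ] _)
                                 (trans (cong (_++ keptItems (suc p) ds R') (concat-snoc Cs B))
                                        (trans (ListP.++-assoc Q B _) (cong (Q ++_) (sym (ListP.++-assoc B K _)))))) ⟩
    OPT (P ++ d ∷ keptBins (suc p) ds R') (Q ++ (B ++ K) ++ leftover ds R') + D' ∎
    where
    open ℚP.≤-Reasoning
    Q = concat Cs
    K = proj₂ (reduceGo i* (suc p) ds (blocks ds R'))
    D' = removedDemand (suc p) ds (blocks ds R')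

  -- The minimality of i* says that no block before bin i* is followed by
  -- an empty one; with positive items this is NoGap.
  noGap-from : ∀ p Bprev Bs → All Positive (Bprev ∷ Bs) →
    (∀ t → suc p ℕ.+ t ℕ.≤ i* → ¬ ((0ℚ < blockLoad (Bprev ∷ Bs) t) × (blockLoad Bs t ≡ 0ℚ))) →
    NoGap (suc p) (null Bprev) Bs
  noGap-from p Bprev []       _                   _         = tt
  noGap-from p Bprev (B ∷ Bs) (Bprev>0 ∷ B>0 ∷ Bs>0) no-drop = next-nonempty , noGap-from (suc p) B Bs (B>0 ∷ Bs>0) no-drop'
    where
    next-nonempty : null Bprev ≡ false → suc p ℕ.≤ i* → null B ≡ false
    next-nonempty Bprev-nonempty p<i* =
      nonempty-after B (no-drop 0 (subst (ℕ._≤ i*) (sym (ℕP.+-identityʳ (suc p))) p<i*))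
      where
      nonempty-after : ∀ B → ¬ ((0ℚ < sumℚ Bprev) × (sumℚ B ≡ 0ℚ)) → null B ≡ false
      nonempty-after []      no-drop₀ = ⊥-elim (no-drop₀ (sumℚ-pos Bprev Bprev>0 Bprev-nonempty , refl))
      nonempty-after (_ ∷ _) _        = refl
    no-drop' : ∀ t → suc (suc p) ℕ.+ t ℕ.≤ i* → ¬ ((0ℚ < blockLoad (B ∷ Bs) t) × (blockLoad Bs t ≡ 0ℚ))
    no-drop' t le = no-drop (suc t) (subst (ℕ._≤ i*) (cong suc (sym (ℕP.+-suc p t))) le)

  noGap-start : ∀ Bs → All Positive Bs →
    (∀ t → 2 ℕ.+ t ℕ.≤ i* → ¬ ((0ℚ < blockLoad Bs t) × (blockLoad Bs (suc t) ≡ 0ℚ))) → NoGap 1 true Bs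
  noGap-start []       _            _       = tt
  noGap-start (B ∷ Bs) (B>0 ∷ Bs>0) no-drop = (λ ()) , noGap-from 1 B Bs (B>0 ∷ Bs>0) no-drop

decreasing : ∀ {xs} → Linked _≥_ xs → Decreasing xs
decreasing = Linked⇒AllPairs (λ x≥y y≥z → ℚP.≤-trans y≥z x≥y)

lemma4 : (ds ss : List ℚ) →
         Linked _≥_ ds → Linked _≥_ ss →
         All (0ℚ <_) ds → All (0ℚ <_) ss →
         (i* : ℕ) → IsIStar ds ss i* →
         ratio (OPT ds ss) (NFD ds ss)
           ≤ ratio (OPT (reducedBins ds ss i*) (reducedItems ds ss i*))
                   (NFD (reducedBins ds ss i*) (reducedItems ds ss i*))
lemma4 ds ss ds↓ ss↓ ds>0 ss>0 i* (_ , _ , _ , _ , minimal) =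
  ratio-remove (OPT ds ss) (NFD ds ss) (OPT I' J') (NFD I' J') D
    (removedDemand-nonneg 1 ds Bs ds>0) (blocksProfit-nonneg I' (blocks I' J') I'>0) (NFD≤OPT I' J' I'>0)
    (NFD-reduced ds ss ds>0 ss≥0) OPT-bound
    (λ N'≡0 → OPT-zero I' J' J'≥0 (NFD-zero I' J' I'>0 N'≡0))
  where
  open Reduction i*
  I' = reducedBins ds ss i*
  J' = reducedItems ds ss i*
  Bs = blocks ds ss
  D  = removedDemand 1 ds Bs
  ss≥0 = All.map ℚP.<⇒≤ ss>0
  I'>0 = keptBins-positive 1 ds Bs ds>0
  J'≥0 = keptItems-nonneg 1 ds ss ds>0 ss≥0
  blocks>0 : All Positive Bs
  blocks>0 = concat⁻ (++⁻ˡ (concat Bs) (subst (All (0ℚ <_)) (nfd-items ds ss ds>0) ss>0))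
  OPT-bound : OPT ds ss ≤ OPT I' J' + D
  OPT-bound = OPT-reduce-from 1 true [] [] ds ss record
    { no-gap       = noGap-start Bs blocks>0 (λ t → minimal (suc t) (ℕ.s≤s ℕ.z≤n))
    ; starts-empty = λ _ → refl
    ; earlier-bins = refl , λ _ ()
    ; dominated    = []
    ; R↓           = decreasing ss↓
    ; R≥0          = ss≥0
    ; kept≥0       = []
    ; ds↓          = decreasing ds↓
    ; ds>0         = ds>0
    ; P≥0          = []
    }
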